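{- Let $n\ge3$ and let $C_n=\mathrm{Cay}(\mathbb{Z}_n,\{1,-1\})$ with its natural colouring. Then $C_n$ is invertible if and only if $n\not\equiv 0\pmod 3$. Moreover, for $m\ge1$, the graph underlying $C_{3m+1}^{ -1}$ is $\mathrm{Cay}(\mathbb{Z}_{3m+1},\{1,3,4,6,\dots,3i-2,3i,\dots,3m-2,3m\})$ and the graph underlying $C_{3m+2}^{ -1}$ is $\mathrm{Cay}(\mathbb{Z}_{3m+2},\{2,3,5,6,\dots,3i-1,3i,\dots,3m-1,3m\})$.
   Context: The natural colouring of a graph colours vertices of even degree white and of odd degree black. For a bicoloured graph $G$ and $u\in V(G)$, $Gu$ has edge set $E(G)\triangle\{[x,y]:x\ne y\in N_G(u)\}$ and the same colouring if $u$ is black, while if $u$ is white the colours of $N_G(u)$ are reversed; $Gu_1\cdots u_k=(\cdots(Gu_1)\cdots)u_k$. $W^\circ(G)$ (parity words) is the smallest set of words containing the empty word with: $s\in W^\circ(G)$, $u$ white in $Gs$ $\Rightarrow su\in W^\circ(G)$; $s\in W^\circ(G)$, $u,v$ adjacent black in $Gs$ $\Rightarrow suvu,svuv\in W^\circ(G)$. A word $s$ is reduced if $s=s_1\cdots s_n$ with pairwise disjoint block letter sets, each block a single vertex or $uvu$ with $[u,v]\in E(Gs_1\cdots s_{i-1})$. $G$ is invertible if some reduced parity word $s$ has letter set $V(G)$; then $G^{ -1}:=Gs$ (independent of the choice of $s$). $\mathrm{Cay}(\mathbb{Z}_n,S)$ has vertex set $\mathbb{Z}_n$ with $x,y$ adjacent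 iff $x-y\in S\cup(-S)$. -}

module Defs where

open import Data.Nat using (ℕ; zero; suc; _+_; _∸_; _≡ᵇ_; _≤ᵇ_; _%_)
open import Data.Bool using (Bool; true; false; _∧_; _∨_; not; _xor_; if_then_else_)
open import Data.Fin using (Fin; toℕ; _≟_)
open import Data.List using (List; []; _∷_; _++_; map; concatMap; allFin)
open import Data.Nat.ListAction using (sum)
open import Data.List.Membership.Propositional using (_∈_)
open import Data.List.Relation.Unary.AllPairs using (AllPairs)
open import Data.List.Relation.Binary.Disjoint.Propositional using (Disjoint)
open import Data.Product using (Σ; _×_; ∃)
open import Data.Unit using (⊤)
open import Relation.Nullary.Decidable using (⌊_⌋)
open import Relation.Binary.PropositionalEquality using (_≡_)

data Colour : Set where
  white black : Colour

record BGraph (n : ℕ) : Set where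
  constructor mkBGraph
  field
    adj : Fin n → Fin n → Bool
    col : Fin n → Colour
open BGraph public

flipIf : Bool → Colour → Colour
flipIf false c = c
flipIf true white = black
flipIf true black = white

-- The operation G ↦ Gu.
-- Edges: E(G) △ {[x,y] : x ≠ y ∈ N_G(u)}.
-- Colours: unchanged if u is black; reversed on N_G(u) if u is white.
lc : ∀ {n} → BGraph n → Fin n → BGraph n
lc G u = mkBGraph
  (λ x y → adj G x y xor (not ⌊ x ≟ y ⌋ ∧ (adj G u x ∧ adj G u y)))
  (λ x → recol (col G u) x)
  where
  recol : Colour → _ → Colour
  recol white x = flipIf (adj G u x) (col G x)
  recol black x = col G x

_·_ : ∀ {n} → BGraph n → List (Fin n) → BGraph n
G · []      = G
G · (u ∷ s) = lc G u · s

degree : ∀ {n} → (Fin n → Fin n → Bool) → Fin n → ℕ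
degree {n} a x = sum (map (λ y → if a x y then 1 else 0) (allFin n))

natural : ∀ {n} → (Fin n → Fin n → Bool) → BGraph n
natural a = mkBGraph a (λ x → if degree a x % 2 ≡ᵇ 0 then white else black)

data Parity {n : ℕ} (G : BGraph n) : List (Fin n) → Set where
  pw-nil   : Parity G []
  pw-white : ∀ {s u} → Parity G s → col (G · s) u ≡ white →
             Parity G (s ++ u ∷ [])
  pw-black : ∀ {s u v} → Parity G s → adj (G · s) u v ≡ true →
             col (G · s) u ≡ black → col (G · s) v ≡ black →
             Parity G (s ++ u ∷ v ∷ u ∷ [])
  pw-black' : ∀ {s u v} → Parity G s → adj (G · s) u v ≡ true →
             col (G · s) u ≡ black → col (G · s) v ≡ black →
             Parity G (s ++ v ∷ u ∷ v ∷ [])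

data Block (n : ℕ) : Set where
  single : Fin n → Block n
  triple : Fin n → Fin n → Block n

letters : ∀ {n} → Block n → List (Fin n)
letters (single u)   = u ∷ []
letters (triple u v) = u ∷ v ∷ u ∷ []

ValidBlocks : ∀ {n} → BGraph n → List (Fin n) → List (Block n) → Set
ValidBlocks G pre []                  = ⊤
ValidBlocks G pre (single u ∷ bs)     = ValidBlocks G (pre ++ u ∷ []) bs
ValidBlocks G pre (triple u v ∷ bs)   =
  adj (G · pre) u v ≡ true × ValidBlocks G (pre ++ u ∷ v ∷ u ∷ []) bs

Reduced : ∀ {n} → BGraph n → List (Fin n) → Set
Reduced {n} G s = Σ (List (Block n)) λ bs →
  (concatMap letters bs ≡ s) ×
  AllPairs Disjoint (map letters bs) ×
  ValidBlocks G [] bs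

InvertingWord : ∀ {n} → BGraph n → List (Fin n) → Set
InvertingWord G s = Parity G s × Reduced G s × (∀ v → v ∈ s)

Invertible : ∀ {n} → BGraph n → Set
Invertible G = ∃ λ s → InvertingWord G s

diff : ∀ {n} → Fin n → Fin n → ℕ
diff {zero}  x y = 0
diff {suc n} x y = (toℕ x + (suc n ∸ toℕ y)) % suc n

-- Cay(ℤ_n, S), S given as a Boolean predicate on residues in [0,n):
-- x ~ y iff x - y ∈ S ∪ (-S), i.e. x - y ∈ S or y - x ∈ S
cay : (n : ℕ) → (ℕ → Bool) → Fin n → Fin n → Bool
cay n S x y = S (diff x y) ∨ S (diff y x)

Cn : (n : ℕ) → BGraph n
Cn n = natural (cay n (λ k → k ≡ᵇ 1))

-- {1,3,4,6,…,3m-2,3m} = {k : 1 ≤ k ≤ 3m, k mod 3 ∈ {0,1}}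
S₁ : ℕ → ℕ → Bool
S₁ m k = (1 ≤ᵇ k) ∧ (k ≤ᵇ 3 Data.Nat.* m) ∧ ((k % 3 ≡ᵇ 0) ∨ (k % 3 ≡ᵇ 1))

-- {2,3,5,6,…,3m-1,3m} = {k : 1 ≤ k ≤ 3m, k mod 3 ∈ {0,2}}
S₂ : ℕ → ℕ → Bool
S₂ m k = (1 ≤ᵇ k) ∧ (k ≤ᵇ 3 Data.Nat.* m) ∧ ((k % 3 ≡ᵇ 0) ∨ (k % 3 ≡ᵇ 2))

-- Over GF(2) a simple bicoloured graph H has the matrix M(H) = A(H) + D, where D is
-- the diagonal indicator of the white vertices.  A local complementation Gu at a white
-- vertex, and a pivot Guvu at an edge between black vertices, act on this matrix as
-- principal pivot transforms: they exchange the coordinates u (resp. u, v) of a and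
-- M a.  Hence a reduced parity word using every vertex once turns M(G) into M(G)⁻¹;
-- conversely, when M(G) is nonsingular, such a word can be built greedily.  For the
-- cycle, M(C_n) = I + S + S⁻¹ with S the cyclic shift.  When 3 ∣ n the vector
-- 011011… lies in its kernel.  Otherwise the closed-neighbourhood matrix of the stated
-- Cayley graph is its inverse: as a function of x - y this matrix is the 3-periodic
-- pattern 110110… (resp. 101101…), whose sums over three consecutive entries vanish.

module Submission where

open import Defs
open import Data.Nat using (ℕ; zero; suc; _+_; _*_; _∸_; _%_; _≤_; _<_; _≡ᵇ_; _≤ᵇ_; z≤n; s≤s)
import Data.Nat.Properties as ℕ
open import Data.Nat.Properties
  using (+-comm; +-assoc; +-suc; +-identityʳ; *-comm; *-suc; *-monoʳ-≤; ≤-refl; ≤-trans; <⇒≤; n≤1+n; m≤m+n;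
         m≤n⇒m<n∨m≡n; m∸n≤m; m∸n+n≡m; m+[n∸m]≡n; ≤⇒≤ᵇ)
open import Data.Nat.DivMod
  using (%-distribˡ-+; %-pred-≡0; m%n%n≡m%n; m%n<n; m<n⇒m%n≡m; n%n≡0; [m+n]%n≡m%n; [m+kn]%n≡m%n)
open import Data.Nat.ListAction using (sum)
open import Data.Bool using (Bool; true; false; _∧_; _∨_; not; _xor_; if_then_else_; T)
import Data.Bool as Bool
open import Data.Bool.Properties
  using (xor-∧-commutativeRing; ∧-distribˡ-xor; ∧-distribʳ-xor; ∧-comm; ∧-zeroʳ; ∧-identityʳ; ∧-idem; ∨-comm;
         xor-identityʳ; xor-comm; not-involutive; T-≡)
open import Data.Empty using (⊥; ⊥-elim)
open import Data.Fin using (Fin; zero; suc; toℕ; fromℕ<)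
open import Data.Fin.Properties using (_≟_; any?; toℕ-injective; toℕ-fromℕ<; toℕ<n)
open import Data.List using (List; []; _∷_; _++_; map; concatMap; allFin; tabulate)
open import Data.List.Properties using (map-++; concatMap-++; ++-assoc; ++-identityʳ; ∷-injectiveˡ; ∷-injectiveʳ)
open import Data.List.Membership.Propositional using (_∈_; _∉_)
open import Data.List.Membership.Propositional.Properties using (∈-++⁻; ∈-++⁺ˡ; ∈-++⁺ʳ; ∈-allFin)
open import Data.List.Relation.Unary.Any using (here; there)
open import Data.List.Relation.Unary.All using (All; []; _∷_)
open import Data.List.Relation.Unary.AllPairs using (AllPairs; []; _∷_)
import Data.List.Relation.Unary.AllPairs.Properties as AllPairs
open import Data.List.Relation.Binary.Disjoint.Propositional using (Disjoint)
open import Data.Maybe using (Maybe; just; nothing)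
open import Data.Product using (Σ; ∃; _×_; _,_)
open import Data.Sum using (_⊎_; inj₁; inj₂)
open import Data.Unit using (⊤; tt)
open import Function using (_∘_)
open import Function.Bundles using (_⇔_; mk⇔; Equivalence)
open import Relation.Binary.PropositionalEquality
open import Relation.Nullary using (¬_; Dec; yes; no; does; contradiction; _×-dec_)
open import Relation.Nullary.Decidable using (⌊_⌋; isYes≗does; dec-true; dec-false; does-⇔; toWitness)
open import Tactic.RingSolver using (solve-∀)
open import Tactic.RingSolver.Core.AlmostCommutativeRing using (AlmostCommutativeRing; fromCommutativeRing)

open ≡-Reasoning

-- Sums over GF(2)

-- Coefficients are Booleans, so normal forms are computed modulo 2 and the
-- solver also proves identities such as x xor x ≡ false.
boolRing : AlmostCommutativeRing _ _
boolRing = fromCommutativeRing xor-∧-commutativeRing isFalse?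
  where
  isFalse? : ∀ x → Maybe (false ≡ x)
  isFalse? false = just refl
  isFalse? true  = nothing

δ : ∀ {n} → Fin n → Fin n → Bool
δ x y = ⌊ x ≟ y ⌋

δ-refl : ∀ {n} (x : Fin n) → δ x x ≡ true
δ-refl x = trans (isYes≗does (x ≟ x)) (dec-true (x ≟ x) refl)

δ-≢ : ∀ {n} {x y : Fin n} → x ≢ y → δ x y ≡ false
δ-≢ {x = x} {y} x≢y = trans (isYes≗does (x ≟ y)) (dec-false (x ≟ y) x≢y)

δ-sym : ∀ {n} (x y : Fin n) → δ x y ≡ δ y x
δ-sym x y = trans (isYes≗does (x ≟ y))
  (trans (does-⇔ (mk⇔ sym sym) (x ≟ y) (y ≟ x)) (sym (isYes≗does (y ≟ x))))

δ⇒≡ : ∀ {n} {x y : Fin n} → δ x y ≡ true → x ≡ y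
δ⇒≡ e = toWitness (subst T (sym e) tt)

δ-suc : ∀ {n} (i u : Fin n) → δ (suc i) (suc u) ≡ δ i u
δ-suc i u with i ≟ u
... | yes _ = refl
... | no  _ = refl

⊕-sum : ∀ {n} → (Fin n → Bool) → Bool
⊕-sum {zero}  f = false
⊕-sum {suc n} f = f zero xor ⊕-sum (f ∘ suc)

⊕-sum-cong : ∀ {n} {f g : Fin n → Bool} → (∀ i → f i ≡ g i) → ⊕-sum f ≡ ⊕-sum g
⊕-sum-cong {zero}  e = refl
⊕-sum-cong {suc n} e = cong₂ _xor_ (e zero) (⊕-sum-cong (e ∘ suc))

⊕-sum-false : ∀ n → ⊕-sum {n} (λ _ → false) ≡ false
⊕-sum-false zero    = refl
⊕-sum-false (suc n) = ⊕-sum-false n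

⊕-sum-xor : ∀ {n} (f g : Fin n → Bool) → ⊕-sum (λ i → f i xor g i) ≡ ⊕-sum f xor ⊕-sum g
⊕-sum-xor {zero}  f g = refl
⊕-sum-xor {suc n} f g =
  trans (cong ((f zero xor g zero) xor_) (⊕-sum-xor (f ∘ suc) (g ∘ suc))) (interchange (f zero) (g zero) (⊕-sum (f ∘ suc)) (⊕-sum (g ∘ suc)))
  where
  interchange : ∀ a b c d → (a xor b) xor (c xor d) ≡ (a xor c) xor (b xor d)
  interchange = solve-∀ boolRing

⊕-sum-∧ˡ : ∀ {n} b (f : Fin n → Bool) → ⊕-sum (λ i → b ∧ f i) ≡ b ∧ ⊕-sum f
⊕-sum-∧ˡ {zero}  b f = sym (∧-zeroʳ b)
⊕-sum-∧ˡ {suc n} b f =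
  trans (cong ((b ∧ f zero) xor_) (⊕-sum-∧ˡ b (f ∘ suc))) (sym (∧-distribˡ-xor b _ _))

⊕-sum-∧ʳ : ∀ {n} (f : Fin n → Bool) b → ⊕-sum (λ i → f i ∧ b) ≡ ⊕-sum f ∧ b
⊕-sum-∧ʳ f b = trans (⊕-sum-cong (λ i → ∧-comm (f i) b)) (trans (⊕-sum-∧ˡ b f) (∧-comm b _))

⊕-sum-δ : ∀ {n} (u : Fin n) (f : Fin n → Bool) → ⊕-sum (λ i → δ i u ∧ f i) ≡ f u
⊕-sum-δ {suc n} zero    f = trans (cong (f zero xor_) (⊕-sum-false n)) (xor-identityʳ (f zero))
⊕-sum-δ {suc n} (suc u) f =
  trans (⊕-sum-cong (λ i → cong (_∧ f (suc i)) (δ-suc i u))) (⊕-sum-δ u (f ∘ suc))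

⊕-sum-δˡ : ∀ {n} (x : Fin n) (f : Fin n → Bool) → ⊕-sum (λ y → δ x y ∧ f y) ≡ f x
⊕-sum-δˡ x f = trans (⊕-sum-cong (λ y → cong (_∧ f y) (δ-sym x y))) (⊕-sum-δ x f)

⊕-sum-δ₂ : ∀ {n} (u v : Fin n) (f : Fin n → Bool) → ⊕-sum (λ y → (δ y u xor δ y v) ∧ f y) ≡ f u xor f v
⊕-sum-δ₂ u v f =
  trans (⊕-sum-cong (λ y → ∧-distribʳ-xor (f y) (δ y u) (δ y v)))
        (trans (⊕-sum-xor (λ y → δ y u ∧ f y) (λ y → δ y v ∧ f y)) (cong₂ _xor_ (⊕-sum-δ u f) (⊕-sum-δ v f)))

⊕-sum-swap : ∀ {m n} (f : Fin m → Fin n → Bool) →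
  ⊕-sum (λ x → ⊕-sum (λ y → f x y)) ≡ ⊕-sum (λ y → ⊕-sum (λ x → f x y))
⊕-sum-swap {zero}  {n} f = sym (⊕-sum-false n)
⊕-sum-swap {suc m} f =
  trans (cong (⊕-sum (f zero) xor_) (⊕-sum-swap (f ∘ suc)))
        (sym (⊕-sum-xor (f zero) (λ y → ⊕-sum (λ x → f (suc x) y))))

-- The matrix of a bicoloured graph

isWhite : Colour → Bool
isWhite white = true
isWhite black = false

isBlack : Colour → Bool
isBlack = not ∘ isWhite

matrix : ∀ {n} → BGraph n → Fin n → Fin n → Bool
matrix H x y = if δ x y then isWhite (col H x) else adj H x y

apply : ∀ {n} → BGraph n → (Fin n → Bool) → Fin n → Bool
apply H a x = ⊕-sum (λ y → matrix H x y ∧ a y)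

apply-cong : ∀ {n} (H : BGraph n) {a b : Fin n → Bool} → (∀ i → a i ≡ b i) → ∀ x → apply H a x ≡ apply H b x
apply-cong H e x = ⊕-sum-cong (λ y → cong (matrix H x y ∧_) (e y))

apply-δ : ∀ {n} (H : BGraph n) z x → apply H (λ y → δ y z) x ≡ matrix H x z
apply-δ H z x = trans (⊕-sum-cong (λ y → ∧-comm (matrix H x y) (δ y z))) (⊕-sum-δ z (matrix H x))

record Simple {n} (H : BGraph n) : Set where
  field
    symmetric : ∀ x y → adj H x y ≡ adj H y x
    loopless  : ∀ x → adj H x x ≡ false
open Simple

adjacent⇒≢ : ∀ {n} {H : BGraph n} {u v} → Simple H → adj H u v ≡ true → u ≢ v
adjacent⇒≢ s uv refl with trans (sym (loopless s _)) uv
... | ()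

lc-simple : ∀ {n} {H : BGraph n} u → Simple H → Simple (lc H u)
lc-simple {H = H} u s .symmetric x y
  rewrite symmetric s x y | δ-sym x y | ∧-comm (adj H u x) (adj H u y) = refl
lc-simple u s .loopless x rewrite δ-refl x | loopless s x = refl

·-simple : ∀ {n} {G : BGraph n} → Simple G → ∀ w → Simple (G · w)
·-simple s []      = s
·-simple s (u ∷ w) = ·-simple (lc-simple u s) w

lc-black-col : ∀ {n} (H : BGraph n) {u} → col H u ≡ black → ∀ y → col (lc H u) y ≡ col H y
lc-black-col H u-black y rewrite u-black = refl

lc-white-col : ∀ {n} (H : BGraph n) {u} → col H u ≡ white → ∀ y → col (lc H u) y ≡ flipIf (adj H u y) (col H y)
lc-white-col H u-white y rewrite u-white = refl

lc-adj-self : ∀ {n} {H : BGraph n} → Simple H → ∀ u z → adj (lc H u) u z ≡ adj H u z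
lc-adj-self {H = H} s u z rewrite loopless s u | ∧-zeroʳ (not (δ u z)) = xor-identityʳ (adj H u z)

matrix-diag : ∀ {n} (H : BGraph n) x → matrix H x x ≡ isWhite (col H x)
matrix-diag H x rewrite δ-refl x = refl

matrix-≢ : ∀ {n} (H : BGraph n) {x y} → x ≢ y → matrix H x y ≡ adj H x y
matrix-≢ H x≢y rewrite δ-≢ x≢y = refl

matrix-sym : ∀ {n} {H : BGraph n} → Simple H → ∀ x y → matrix H x y ≡ matrix H y x
matrix-sym {H = H} s x y = by-cases (x ≟ y)
  where
  by-cases : Dec (x ≡ y) → matrix H x y ≡ matrix H y x
  by-cases (yes refl) = refl
  by-cases (no x≢y)   = trans (matrix-≢ H x≢y) (trans (symmetric s x y) (sym (matrix-≢ H (x≢y ∘ sym))))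

matrix-adj : ∀ {n} {H : BGraph n} → Simple H → ∀ x y →
  matrix H x y ≡ adj H x y xor (δ x y ∧ isWhite (col H x))
matrix-adj {H = H} s x y with x ≟ y
... | yes refl rewrite loopless s x = refl
... | no _     = sym (xor-identityʳ _)

apply-adj : ∀ {n} {H : BGraph n} → Simple H → ∀ c x →
  apply H c x ≡ ⊕-sum (λ y → adj H x y ∧ c y) xor (isWhite (col H x) ∧ c x)
apply-adj {H = H} s c x = begin
  apply H c x
    ≡⟨ ⊕-sum-cong (λ y → trans (cong (_∧ c y) (matrix-adj s x y)) (distrib (adj H x y) (δ x y) w (c y))) ⟩
  ⊕-sum (λ y → (adj H x y ∧ c y) xor (w ∧ (δ x y ∧ c y)))
    ≡⟨ ⊕-sum-xor (λ y → adj H x y ∧ c y) (λ y → w ∧ (δ x y ∧ c y)) ⟩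
  ⊕-sum (λ y → adj H x y ∧ c y) xor ⊕-sum (λ y → w ∧ (δ x y ∧ c y))
    ≡⟨ cong (⊕-sum (λ y → adj H x y ∧ c y) xor_) (trans (⊕-sum-∧ˡ w (λ y → δ x y ∧ c y)) (cong (w ∧_) (⊕-sum-δˡ x c))) ⟩
  ⊕-sum (λ y → adj H x y ∧ c y) xor (w ∧ c x) ∎
  where
  w = isWhite (col H x)
  distrib : ∀ a d w c → (a xor (d ∧ w)) ∧ c ≡ (a ∧ c) xor (w ∧ (d ∧ c))
  distrib = solve-∀ boolRing

isWhite-flipIf : ∀ b c → isWhite (flipIf b c) ≡ isWhite c xor b
isWhite-flipIf false c     = sym (xor-identityʳ (isWhite c))
isWhite-flipIf true  white = refl
isWhite-flipIf true  black = refl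

matrix-lc : ∀ {n} (H : BGraph n) u x y →
  matrix (lc H u) x y ≡
  matrix H x y xor (adj H u x ∧ adj H u y) xor (isBlack (col H u) ∧ (δ x y ∧ adj H u x))
matrix-lc H u x y with x ≟ y | col H u
... | no _     | k     rewrite ∧-zeroʳ (isBlack k) = sym (cong (adj H x y xor_) (xor-identityʳ _))
... | yes refl | white rewrite ∧-idem (adj H u x) =
  trans (isWhite-flipIf (adj H u x) (col H x)) (cong (isWhite (col H x) xor_) (sym (xor-identityʳ _)))
... | yes refl | black rewrite ∧-idem (adj H u x) = sym (cancel (isWhite (col H x)) (adj H u x))
  where
  cancel : ∀ a b → a xor (b xor b) ≡ a
  cancel = solve-∀ boolRing

apply-lc : ∀ {n} {H : BGraph n} → Simple H → ∀ u c x →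
  apply (lc H u) c x ≡
  apply H c x xor (adj H u x ∧ (⊕-sum (λ y → adj H u y ∧ c y) xor (isBlack (col H u) ∧ c x)))
apply-lc {H = H} s u c x = begin
  apply (lc H u) c x
    ≡⟨ ⊕-sum-cong (λ y → trans (cong (_∧ c y) (matrix-lc H u x y))
                               (distrib (matrix H x y) p (adj H u y) k (δ x y) (c y))) ⟩
  ⊕-sum (λ y → (matrix H x y ∧ c y) xor ((p ∧ (adj H u y ∧ c y)) xor ((k ∧ p) ∧ (δ x y ∧ c y))))
    ≡⟨ ⊕-sum-xor (λ y → matrix H x y ∧ c y) _ ⟩
  apply H c x xor ⊕-sum (λ y → (p ∧ (adj H u y ∧ c y)) xor ((k ∧ p) ∧ (δ x y ∧ c y)))
    ≡⟨ cong (apply H c x xor_) (⊕-sum-xor (λ y → p ∧ (adj H u y ∧ c y)) _) ⟩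
  apply H c x xor (⊕-sum (λ y → p ∧ (adj H u y ∧ c y)) xor ⊕-sum (λ y → (k ∧ p) ∧ (δ x y ∧ c y)))
    ≡⟨ cong (apply H c x xor_) (cong₂ _xor_ (⊕-sum-∧ˡ p (λ y → adj H u y ∧ c y))
                                            (trans (⊕-sum-∧ˡ (k ∧ p) (λ y → δ x y ∧ c y)) (cong ((k ∧ p) ∧_) (⊕-sum-δˡ x c)))) ⟩
  apply H c x xor ((p ∧ S) xor ((k ∧ p) ∧ c x))
    ≡⟨ regroup (apply H c x) p S k (c x) ⟩
  apply H c x xor (p ∧ (S xor (k ∧ c x))) ∎
  where
  p = adj H u x
  k = isBlack (col H u)
  S = ⊕-sum (λ y → adj H u y ∧ c y)
  distrib : ∀ m p q k d c → (m xor (p ∧ q) xor (k ∧ (d ∧ p))) ∧ c ≡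
                            (m ∧ c) xor ((p ∧ (q ∧ c)) xor ((k ∧ p) ∧ (d ∧ c)))
  distrib = solve-∀ boolRing
  regroup : ∀ a p S k c → a xor ((p ∧ S) xor ((k ∧ p) ∧ c)) ≡ a xor (p ∧ (S xor (k ∧ c)))
  regroup = solve-∀ boolRing

neighbourhood-sum : ∀ {n} {H : BGraph n} → Simple H → ∀ u c →
  ⊕-sum (λ y → adj H u y ∧ c y) ≡ apply H c u xor (isWhite (col H u) ∧ c u)
neighbourhood-sum {H = H} s u c =
  trans (sym (cancel _ (isWhite (col H u) ∧ c u))) (cong (_xor (isWhite (col H u) ∧ c u)) (sym (apply-adj s c u)))
  where
  cancel : ∀ a b → (a xor b) xor b ≡ a
  cancel = solve-∀ boolRing

apply-lc-black : ∀ {n} {H : BGraph n} → Simple H → ∀ {u} → col H u ≡ black → ∀ c x →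
  apply (lc H u) c x ≡ apply H c x xor (adj H u x ∧ (apply H c u xor c x))
apply-lc-black {H = H} s {u} u-black c x =
  trans (apply-lc s u c x) (cong (λ z → apply H c x xor (adj H u x ∧ z))
    (cong₂ _xor_ row (cong (λ k → isBlack k ∧ c x) u-black)))
  where
  row : ⊕-sum (λ y → adj H u y ∧ c y) ≡ apply H c u
  row = trans (neighbourhood-sum s u c)
              (trans (cong (λ k → apply H c u xor (isWhite k ∧ c u)) u-black) (xor-identityʳ _))

apply-lc-white : ∀ {n} {H : BGraph n} → Simple H → ∀ {u} → col H u ≡ white → ∀ c x →
  apply (lc H u) c x ≡ apply H c x xor (adj H u x ∧ (apply H c u xor c u))
apply-lc-white {H = H} s {u} u-white c x =
  trans (apply-lc s u c x) (cong (λ z → apply H c x xor (adj H u x ∧ z))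
    (trans (cong₂ _xor_ row (cong (λ k → isBlack k ∧ c x) u-white)) (xor-identityʳ _)))
  where
  row : ⊕-sum (λ y → adj H u y ∧ c y) ≡ apply H c u xor c u
  row = trans (neighbourhood-sum s u c) (cong (λ k → apply H c u xor (isWhite k ∧ c u)) u-white)

-- Partial inverses

select : ∀ {n} → (Fin n → Bool) → (Fin n → Bool) → (Fin n → Bool) → Fin n → Bool
select m a b x = if m x then b x else a x

-- H′ is the partial inverse (principal pivot transform) of H on the vertex set m:
-- exchanging the m-coordinates of a and H a turns the pair (a , H a) into a pair
-- (c , H′ c).  When m is the whole vertex set, H′ is the inverse of H.
infix 4 _⇄⟨_⟩_
_⇄⟨_⟩_ : ∀ {n} → BGraph n → (Fin n → Bool) → BGraph n → Set
H ⇄⟨ m ⟩ H′ = ∀ a x → apply H′ (select m a (apply H a)) x ≡ select m (apply H a) a x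

⇄-refl : ∀ {n} (H : BGraph n) → H ⇄⟨ (λ _ → false) ⟩ H
⇄-refl H a x = refl

⇄-trans : ∀ {n} {A B C : BGraph n} {m₁ m₂} →
  A ⇄⟨ m₁ ⟩ B → B ⇄⟨ m₂ ⟩ C → A ⇄⟨ (λ x → m₁ x xor m₂ x) ⟩ C
⇄-trans {A = A} {B} {C} {m₁} {m₂} AB BC a x =
  trans (apply-cong C (λ i → trans (sym (select-xor (m₁ i) (m₂ i) (a i) (apply A a i)))
                                   (cong (λ z → if m₂ i then z else b i) (sym (AB a i)))) x)
    (trans (BC b x)
      (trans (cong (λ z → if m₂ x then b x else z) (AB a x)) (select-xor (m₁ x) (m₂ x) (apply A a x) (a x))))
  where
  b = select m₁ a (apply A a)
  select-xor : ∀ p q (a b : Bool) →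
    (if q then (if p then a else b) else (if p then b else a)) ≡ (if p xor q then b else a)
  select-xor false false a b = refl
  select-xor false true  a b = refl
  select-xor true  false a b = refl
  select-xor true  true  a b = refl

⇄-mask : ∀ {n} {H H′ : BGraph n} {m m′} → (∀ x → m x ≡ m′ x) → H ⇄⟨ m ⟩ H′ → H ⇄⟨ m′ ⟩ H′
⇄-mask {H = H} {H′} {m} {m′} e HH′ a x =
  trans (apply-cong H′ (λ i → cong (λ z → if z then apply H a i else a i) (sym (e i))) x)
    (trans (HH′ a x) (cong (λ z → if z then a x else apply H a x) (e x)))

⇄-resp : ∀ {n} {H H′ H″ : BGraph n} {m} → (∀ c x → apply H′ c x ≡ apply H″ c x) →
  H ⇄⟨ m ⟩ H′ → H ⇄⟨ m ⟩ H″
⇄-resp e HH′ a x = trans (sym (e _ x)) (HH′ a x)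

mask : ∀ {n} → Block n → Fin n → Bool
mask (single u)   x = δ x u
mask (triple u v) x = δ x u xor δ x v

apply-select : ∀ {n} (H : BGraph n) m a b x →
  apply H (select m a b) x ≡ apply H a x xor ⊕-sum (λ y → m y ∧ (matrix H x y ∧ (b y xor a y)))
apply-select H m a b x =
  trans (⊕-sum-cong (λ y → pointwise (m y) (matrix H x y) (a y) (b y)))
        (⊕-sum-xor (λ y → matrix H x y ∧ a y) (λ y → m y ∧ (matrix H x y ∧ (b y xor a y))))
  where
  pointwise : ∀ m M a b → M ∧ (if m then b else a) ≡ (M ∧ a) xor (m ∧ (M ∧ (b xor a)))
  pointwise false M a b = sym (xor-identityʳ _)
  pointwise true  M a b = solve M a b
    where
    solve : ∀ M a b → M ∧ b ≡ (M ∧ a) xor (M ∧ (b xor a))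
    solve = solve-∀ boolRing

lc-white-⇄ : ∀ {n} {H : BGraph n} {u} → Simple H → col H u ≡ white → H ⇄⟨ mask (single u) ⟩ lc H u
lc-white-⇄ {H = H} {u} s u-white a x = begin
  apply (lc H u) c x                                     ≡⟨ apply-lc-white s u-white c x ⟩
  apply H c x xor (adj H u x ∧ (apply H c u xor c u))    ≡⟨ cong₂ (λ y z → y xor (adj H u x ∧ z)) (apply-c x) row-u ⟩
  (Ha x xor (matrix H x u ∧ α)) xor (adj H u x ∧ α)      ≡⟨ exchange (x ≟ u) ⟩
  select (mask (single u)) Ha a x                        ∎
  where
  Ha = apply H a
  α = Ha u xor a u
  c = select (mask (single u)) a Ha
  apply-c : ∀ z → apply H c z ≡ Ha z xor (matrix H z u ∧ α)
  apply-c z = trans (apply-select H (mask (single u)) a Ha z)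
                    (cong (Ha z xor_) (⊕-sum-δ u (λ y → matrix H z y ∧ (Ha y xor a y))))
  matrix-uu : matrix H u u ≡ true
  matrix-uu = trans (matrix-diag H u) (cong isWhite u-white)
  c-u : c u ≡ Ha u
  c-u rewrite δ-refl u = refl
  row-u : apply H c u xor c u ≡ α
  row-u = trans (cong₂ _xor_ (trans (apply-c u) (cong (λ m → Ha u xor (m ∧ α)) matrix-uu)) c-u) (cancel (Ha u) α)
    where
    cancel : ∀ h α → (h xor α) xor h ≡ α
    cancel = solve-∀ boolRing
  exchange : Dec (x ≡ u) → (Ha x xor (matrix H x u ∧ α)) xor (adj H u x ∧ α) ≡ select (mask (single u)) Ha a x
  exchange (yes refl) =
    trans (cong₂ (λ m p → (Ha x xor (m ∧ α)) xor (p ∧ α)) matrix-uu (loopless s x))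
          (trans (xor-identityʳ _) (trans (cancel (Ha x) (a x)) (cong (λ d → if d then a x else Ha x) (sym (δ-refl x)))))
    where
    cancel : ∀ h a → h xor (h xor a) ≡ a
    cancel = solve-∀ boolRing
  exchange (no x≢u) =
    trans (cong (λ m → (Ha x xor (m ∧ α)) xor (adj H u x ∧ α)) (trans (matrix-≢ H x≢u) (symmetric s x u)))
          (trans (cancel (Ha x) (adj H u x) α) (cong (λ d → if d then a x else Ha x) (sym (δ-≢ x≢u))))
    where
    cancel : ∀ h p α → (h xor (p ∧ α)) xor (p ∧ α) ≡ h
    cancel = solve-∀ boolRing

-- The pivot uvu is three black local complementations, each a rank-one update of
-- the matrix (apply-lc-black).
module Pivot {n} {H : BGraph n} {u v} (s : Simple H) (uv : adj H u v ≡ true)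
             (u-black : col H u ≡ black) (v-black : col H v ≡ black) where

  H₁ = lc H u
  H₂ = lc H₁ v
  s₁ = lc-simple u s
  s₂ = lc-simple v s₁

  v-black₁ : col H₁ v ≡ black
  v-black₁ = trans (lc-black-col H u-black v) v-black

  u-black₂ : col H₂ u ≡ black
  u-black₂ = trans (lc-black-col H₁ v-black₁ u) (trans (lc-black-col H u-black u) u-black)

  u≢v : u ≢ v
  u≢v = adjacent⇒≢ s uv

  r : Fin n → Bool
  r = adj H₁ v

  t : Fin n → Bool
  t = adj H₂ u

  r-u : r u ≡ true
  r-u = trans (symmetric s₁ v u) (trans (lc-adj-self s u v) uv)

  r-off : ∀ {x} → x ≢ v → r x ≡ adj H v x xor adj H u x
  r-off x≢v rewrite δ-≢ (x≢v ∘ sym) | uv = refl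

  t-v : t v ≡ true
  t-v = trans (symmetric s₂ u v) (trans (lc-adj-self s₁ v u) r-u)

  t-off : ∀ {x} → x ≢ u → x ≢ v → t x ≡ adj H u x xor (adj H v x xor adj H u x)
  t-off {x} x≢u x≢v = trans (cong₂ (λ p q → p xor (not (δ u x) ∧ q)) (lc-adj-self s u x) (cong₂ _∧_ r-u (r-off x≢v)))
                            (cong (λ d → adj H u x xor (not d ∧ (adj H v x xor adj H u x))) (δ-≢ (x≢u ∘ sym)))

  module _ (c : Fin n → Bool) where
    y₀ = apply H c
    y₁v = y₀ v xor (y₀ u xor c v)
    y₂u = y₀ u xor (y₁v xor c u)

    unrolled : ∀ z → apply (H · (u ∷ v ∷ u ∷ [])) c z ≡
      ((y₀ z xor (adj H u z ∧ (y₀ u xor c z))) xor (r z ∧ (y₁v xor c z))) xor (t z ∧ (y₂u xor c z))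
    unrolled z = begin
      apply (lc H₂ u) c z                                             ≡⟨ apply-lc-black s₂ u-black₂ c z ⟩
      apply H₂ c z xor (t z ∧ (apply H₂ c u xor c z))                 ≡⟨ cong₂ (λ y w → y xor (t z ∧ (w xor c z)))
                                                                             (apply-lc-black s₁ v-black₁ c z) H₂-u ⟩
      (apply H₁ c z xor (r z ∧ (apply H₁ c v xor c z))) xor (t z ∧ (y₂u xor c z))
                                                                       ≡⟨ cong₂ (λ y w → (y xor (r z ∧ (w xor c z))) xor (t z ∧ (y₂u xor c z)))
                                                                             (apply-lc-black s u-black c z) H₁-v ⟩
      ((y₀ z xor (adj H u z ∧ (y₀ u xor c z))) xor (r z ∧ (y₁v xor c z))) xor (t z ∧ (y₂u xor c z)) ∎
      where
      H₁-u : apply H₁ c u ≡ y₀ u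
      H₁-u = trans (apply-lc-black s u-black c u)
                   (trans (cong (λ p → y₀ u xor (p ∧ (y₀ u xor c u))) (loopless s u)) (xor-identityʳ _))
      H₁-v : apply H₁ c v ≡ y₁v
      H₁-v = trans (apply-lc-black s u-black c v) (cong (λ p → y₀ v xor (p ∧ (y₀ u xor c v))) uv)
      H₂-u : apply H₂ c u ≡ y₂u
      H₂-u = trans (apply-lc-black s₁ v-black₁ c u)
                   (trans (cong₂ (λ y q → y xor (q ∧ (apply H₁ c v xor c u))) H₁-u r-u)
                          (cong (λ w → y₀ u xor (w xor c u)) H₁-v))

  pivot-⇄ : H ⇄⟨ mask (triple u v) ⟩ H · (u ∷ v ∷ u ∷ [])
  pivot-⇄ a x = exchange (x ≟ u) (x ≟ v)
    where
    Ha = apply H a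
    α = Ha u xor a u
    β = Ha v xor a v
    c = select (mask (triple u v)) a Ha
    F : Bool → Bool → Bool → Bool → Bool → Bool → Bool → Bool
    F y p r t c y₁v y₂u = ((y xor (p ∧ ((Ha u xor β) xor c))) xor (r ∧ (y₁v xor c))) xor (t ∧ (y₂u xor c))
    y₀-formula : ∀ z → y₀ c z ≡ Ha z xor ((matrix H z u ∧ α) xor (matrix H z v ∧ β))
    y₀-formula z = trans (apply-select H (mask (triple u v)) a Ha z)
                         (cong (Ha z xor_) (⊕-sum-δ₂ u v (λ y → matrix H z y ∧ (Ha y xor a y))))
    y₀-u : y₀ c u ≡ Ha u xor β
    y₀-u = trans (y₀-formula u) (cong₂ (λ m m′ → Ha u xor ((m ∧ α) xor (m′ ∧ β)))
      (trans (matrix-diag H u) (cong isWhite u-black)) (trans (matrix-≢ H u≢v) uv))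
    y₀-v : y₀ c v ≡ Ha v xor α
    y₀-v = trans (y₀-formula v) (trans (cong₂ (λ m m′ → Ha v xor ((m ∧ α) xor (m′ ∧ β)))
      (trans (matrix-≢ H (u≢v ∘ sym)) (trans (symmetric s v u) uv)) (trans (matrix-diag H v) (cong isWhite v-black)))
      (cong (Ha v xor_) (xor-identityʳ α)))
    c-u : c u ≡ Ha u
    c-u rewrite δ-refl u | δ-≢ u≢v = refl
    c-v : c v ≡ Ha v
    c-v rewrite δ-refl v | δ-≢ (u≢v ∘ sym) = refl
    y₁v-value : y₁v c ≡ a u xor β
    y₁v-value = trans (cong₂ (λ y w → y xor (w xor c v)) y₀-v y₀-u)
                      (trans (cong (λ w → (Ha v xor α) xor ((Ha u xor β) xor w)) c-v) (cancel (Ha u) (a u) (Ha v) β))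
      where
      cancel : ∀ h a k β → (k xor (h xor a)) xor ((h xor β) xor k) ≡ a xor β
      cancel = solve-∀ boolRing
    y₂u-value : y₂u c ≡ a u
    y₂u-value = trans (cong₂ (λ y w → y xor (w xor c u)) y₀-u y₁v-value)
                      (trans (cong (λ w → (Ha u xor β) xor ((a u xor β) xor w)) c-u) (cancel (Ha u) (a u) β))
      where
      cancel : ∀ h a β → (h xor β) xor ((a xor β) xor h) ≡ a
      cancel = solve-∀ boolRing
    at : ∀ z → apply (H · (u ∷ v ∷ u ∷ [])) c z ≡ F (y₀ c z) (adj H u z) (r z) (t z) (c z) (a u xor β) (a u)
    at z = trans (unrolled c z)
      (cong₃ (λ w w′ w″ → ((y₀ c z xor (adj H u z ∧ (w xor c z))) xor (r z ∧ (w′ xor c z))) xor (t z ∧ (w″ xor c z)))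
             y₀-u y₁v-value y₂u-value)
      where
      cong₃ : ∀ (f : Bool → Bool → Bool → Bool) {a a′ b b′ d d′} → a ≡ a′ → b ≡ b′ → d ≡ d′ → f a b d ≡ f a′ b′ d′
      cong₃ f refl refl refl = refl
    F-cong : ∀ {y y′ p p′ r r′ t t′ c c′} → y ≡ y′ → p ≡ p′ → r ≡ r′ → t ≡ t′ → c ≡ c′ →
      F y p r t c (a u xor β) (a u) ≡ F y′ p′ r′ t′ c′ (a u xor β) (a u)
    F-cong refl refl refl refl refl = refl
    target : ∀ {d e} → δ x u ≡ d → δ x v ≡ e → select (mask (triple u v)) Ha a x ≡ (if d xor e then a x else Ha x)
    target refl refl = refl
    exchange : Dec (x ≡ u) → Dec (x ≡ v) → apply (H · (u ∷ v ∷ u ∷ [])) c x ≡ select (mask (triple u v)) Ha a x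
    exchange (yes refl) _ = begin
      apply (H · (u ∷ v ∷ u ∷ [])) c u                         ≡⟨ at u ⟩
      F (y₀ c u) (adj H u u) (r u) (t u) (c u) (a u xor β) (a u) ≡⟨ F-cong y₀-u (loopless s u) r-u (loopless s₂ u) c-u ⟩
      F (Ha u xor β) false true false (Ha u) (a u xor β) (a u)   ≡⟨ cancel (Ha u) (a u) β ⟩
      a u                                                      ≡⟨ sym (target (δ-refl u) (δ-≢ u≢v)) ⟩
      select (mask (triple u v)) Ha a u                        ∎
      where
      cancel : ∀ h a β →
        (((h xor β) xor (false ∧ ((h xor β) xor h))) xor (true ∧ ((a xor β) xor h))) xor (false ∧ (a xor h)) ≡ a
      cancel = solve-∀ boolRing
    exchange (no v≢u) (yes refl) = begin
      apply (H · (u ∷ v ∷ u ∷ [])) c v                         ≡⟨ at v ⟩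
      F (y₀ c v) (adj H u v) (r v) (t v) (c v) (a u xor β) (a u) ≡⟨ F-cong y₀-v uv (loopless s₁ v) t-v c-v ⟩
      F (Ha v xor α) true false true (Ha v) (a u xor β) (a u)    ≡⟨ cancel (Ha u) (Ha v) (a u) (a v) ⟩
      a v                                                      ≡⟨ sym (target (δ-≢ v≢u) (δ-refl v)) ⟩
      select (mask (triple u v)) Ha a v                        ∎
      where
      cancel : ∀ hu hv au av →
        (((hv xor (hu xor au)) xor (true ∧ ((hu xor (hv xor av)) xor hv)))
          xor (false ∧ ((au xor (hv xor av)) xor hv))) xor (true ∧ (au xor hv)) ≡ av
      cancel = solve-∀ boolRing
    exchange (no x≢u) (no x≢v) = begin
      apply (H · (u ∷ v ∷ u ∷ [])) c x                         ≡⟨ at x ⟩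
      F (y₀ c x) (adj H u x) (r x) (t x) (c x) (a u xor β) (a u) ≡⟨ F-cong y₀-x refl (r-off x≢v) (t-off x≢u x≢v) c-x ⟩
      F (Ha x xor ((adj H u x ∧ α) xor (adj H v x ∧ β))) (adj H u x) (adj H v x xor adj H u x)
        (adj H u x xor (adj H v x xor adj H u x)) (a x) (a u xor β) (a u)
                                                               ≡⟨ cancel (Ha x) (Ha u) (Ha v) (a x) (a u) (a v) (adj H u x) (adj H v x) ⟩
      Ha x                                                     ≡⟨ sym (target (δ-≢ x≢u) (δ-≢ x≢v)) ⟩
      select (mask (triple u v)) Ha a x                        ∎
      where
      y₀-x : y₀ c x ≡ Ha x xor ((adj H u x ∧ α) xor (adj H v x ∧ β))
      y₀-x = trans (y₀-formula x) (cong₂ (λ m m′ → Ha x xor ((m ∧ α) xor (m′ ∧ β)))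
        (trans (matrix-≢ H x≢u) (symmetric s x u)) (trans (matrix-≢ H x≢v) (symmetric s x v)))
      c-x : c x ≡ a x
      c-x rewrite δ-≢ x≢u | δ-≢ x≢v = refl
      cancel : ∀ hx hu hv ax au av p q →
        ((((hx xor ((p ∧ (hu xor au)) xor (q ∧ (hv xor av)))) xor (p ∧ ((hu xor (hv xor av)) xor ax)))
          xor ((q xor p) ∧ ((au xor (hv xor av)) xor ax))) xor ((p xor (q xor p)) ∧ (au xor ax))) ≡ hx
      cancel = solve-∀ boolRing

open Pivot using (pivot-⇄)

-- Reduced parity words invert the matrix

·-++ : ∀ {n} (G : BGraph n) p q → G · (p ++ q) ≡ (G · p) · q
·-++ G []      q = refl
·-++ G (u ∷ p) q = ·-++ (lc G u) p q

Legal : ∀ {n} → BGraph n → List (Fin n) → Block n → Set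
Legal G w (single u)   = col (G · w) u ≡ white
Legal G w (triple u v) = adj (G · w) u v ≡ true × col (G · w) u ≡ black × col (G · w) v ≡ black

LegalBlocks : ∀ {n} → BGraph n → List (Fin n) → List (Block n) → Set
LegalBlocks G pre []       = ⊤
LegalBlocks G pre (b ∷ bs) = Legal G pre b × LegalBlocks G (pre ++ letters b) bs

legalBlocks-snoc : ∀ {n} (G : BGraph n) pre bs b →
  LegalBlocks G pre bs → Legal G (pre ++ concatMap letters bs) b → LegalBlocks G pre (bs ++ b ∷ [])
legalBlocks-snoc G pre []        b _          legal = subst (λ w → Legal G w b) (++-identityʳ pre) legal , tt
legalBlocks-snoc G pre (b′ ∷ bs) b (l , ls) legal =
  l , legalBlocks-snoc G (pre ++ letters b′) bs b ls
        (subst (λ w → Legal G w b) (sym (++-assoc pre (letters b′) (concatMap letters bs))) legal)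

concatMap-snoc : ∀ {n} (bs : List (Block n)) b → concatMap letters (bs ++ b ∷ []) ≡ concatMap letters bs ++ letters b
concatMap-snoc bs b =
  trans (concatMap-++ letters bs (b ∷ [])) (cong (concatMap letters bs ++_) (++-identityʳ (letters b)))

LegalParsing : ∀ {n} → BGraph n → List (Fin n) → Set
LegalParsing {n} G s = Σ (List (Block n)) λ bs → concatMap letters bs ≡ s × LegalBlocks G [] bs

legalParsing-snoc : ∀ {n} {G : BGraph n} {s} b → LegalParsing G s → Legal G s b → LegalParsing G (s ++ letters b)
legalParsing-snoc {G = G} b (bs , e , ls) legal =
  bs ++ b ∷ [] , trans (concatMap-snoc bs b) (cong (_++ letters b) e) ,
  legalBlocks-snoc G [] bs b ls (subst (λ w → Legal G w b) (sym e) legal)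

parity⇒legalParsing : ∀ {n} {G : BGraph n} → Simple G → ∀ {s} → Parity G s → LegalParsing G s
parity⇒legalParsing s pw-nil = [] , refl , tt
parity⇒legalParsing s (pw-white {u = u} P u-white) =
  legalParsing-snoc (single u) (parity⇒legalParsing s P) u-white
parity⇒legalParsing s (pw-black {u = u} {v} P uv u-black v-black) =
  legalParsing-snoc (triple u v) (parity⇒legalParsing s P) (uv , u-black , v-black)
parity⇒legalParsing {G = G} s (pw-black' {s = w} {u} {v} P uv u-black v-black) =
  legalParsing-snoc (triple v u) (parity⇒legalParsing s P) (trans (symmetric (·-simple s w) v u) uv , v-black , u-black)

masks : ∀ {n} → List (Block n) → Fin n → Bool
masks []       x = false
masks (b ∷ bs) x = mask b x xor masks bs x

masks-snoc : ∀ {n} (bs : List (Block n)) b x → masks (bs ++ b ∷ []) x ≡ mask b x xor masks bs x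
masks-snoc []        b x = refl
masks-snoc (b′ ∷ bs) b x = trans (cong (mask b′ x xor_) (masks-snoc bs b x)) (swap (mask b′ x) (mask b x) (masks bs x))
  where
  swap : ∀ p q r → p xor (q xor r) ≡ q xor (p xor r)
  swap = solve-∀ boolRing

legal-⇄ : ∀ {n} {G : BGraph n} → Simple G → ∀ pre b → Legal G pre b → G · pre ⇄⟨ mask b ⟩ G · (pre ++ letters b)
legal-⇄ {G = G} s pre (single u) u-white =
  subst (G · pre ⇄⟨ mask (single u) ⟩_) (sym (·-++ G pre (u ∷ []))) (lc-white-⇄ (·-simple s pre) u-white)
legal-⇄ {G = G} s pre (triple u v) (uv , u-black , v-black) =
  subst (G · pre ⇄⟨ mask (triple u v) ⟩_) (sym (·-++ G pre (u ∷ v ∷ u ∷ [])))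
        (pivot-⇄ (·-simple s pre) uv u-black v-black)

legalBlocks-⇄ : ∀ {n} {G : BGraph n} → Simple G → ∀ pre bs → LegalBlocks G pre bs →
  G · pre ⇄⟨ masks bs ⟩ G · (pre ++ concatMap letters bs)
legalBlocks-⇄ {G = G} s pre [] _ =
  subst (λ w → G · pre ⇄⟨ masks [] ⟩ G · w) (sym (++-identityʳ pre)) (⇄-refl (G · pre))
legalBlocks-⇄ {G = G} s pre (b ∷ bs) (l , ls) =
  subst (λ w → G · pre ⇄⟨ masks (b ∷ bs) ⟩ G · w) (++-assoc pre (letters b) (concatMap letters bs))
        (⇄-trans (legal-⇄ s pre b l) (legalBlocks-⇄ s (pre ++ letters b) bs ls))

∉-concatMap : ∀ {n} {x : Fin n} {L} bs → All (Disjoint L) (map letters bs) → x ∈ L → x ∉ concatMap letters bs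
∉-concatMap (b ∷ bs) (d ∷ ds) x∈L x∈bs with ∈-++⁻ (letters b) x∈bs
... | inj₁ x∈b  = d (x∈L , x∈b)
... | inj₂ x∈bs′ = ∉-concatMap bs ds x∈L x∈bs′

white-pair-blackens : ∀ {n} {H : BGraph n} {u v} → Simple H → adj H u v ≡ true →
  col H u ≡ white → col (lc H u) v ≡ white → col (lc (lc H u) v) u ≡ black
white-pair-blackens {H = H} {u} {v} s uv u-white v-white =
  trans (lc-white-col (lc H u) v-white u)
        (cong₂ flipIf (trans (symmetric (lc-simple u s) v u) (trans (lc-adj-self s u v) uv))
                      (trans (lc-white-col H u-white u) (cong₂ flipIf (loopless s u) u-white)))

module _ {n} {G : BGraph n} (s : Simple G) where

  -- A legal single step u cannot be continued by legal steps spelling v u: after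
  -- the white steps u and v the vertex u has turned black.
  no-split-triple : ∀ pre u v (ps bs : List (Block n)) → col (G · pre) u ≡ white → adj (G · pre) u v ≡ true →
    All (Disjoint (u ∷ v ∷ u ∷ [])) (map letters bs) → LegalBlocks G (pre ++ u ∷ []) ps →
    concatMap letters ps ≢ v ∷ u ∷ concatMap letters bs
  no-split-triple pre u v [] bs u-white uv d ls ()
  no-split-triple pre u v (triple w z ∷ ps) bs u-white uv d ls e with ∷-injectiveˡ e
  ... | refl = ∉-concatMap bs d (there (here refl)) (subst (w ∈_) (∷-injectiveʳ (∷-injectiveʳ e)) (here refl))
  no-split-triple pre u v (single w ∷ []) bs u-white uv d ls e with ∷-injectiveʳ e
  ... | ()
  no-split-triple pre u v (single w ∷ triple w′ z ∷ ps) bs u-white uv d ls e with ∷-injectiveˡ (∷-injectiveʳ e)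
  ... | refl = ∉-concatMap bs d (here refl) (subst (w′ ∈_) (∷-injectiveʳ (∷-injectiveʳ e)) (there (here refl)))
  no-split-triple pre u v (single w ∷ single w′ ∷ ps) bs u-white uv d (v-white , u-white′ , _) e
    with ∷-injectiveˡ e | ∷-injectiveˡ (∷-injectiveʳ e)
  ... | refl | refl = white≢black (trans (sym u-white″) (white-pair-blackens (·-simple s pre) uv u-white v-white′))
    where
    white≢black : white ≢ black
    white≢black ()
    v-white′ : col (lc (G · pre) u) w ≡ white
    v-white′ = subst (λ H → col H w ≡ white) (·-++ G pre (u ∷ [])) v-white
    u-white″ : col (lc (lc (G · pre) u) w) u ≡ white
    u-white″ = subst (λ H → col H u ≡ white) (·-++ G pre (u ∷ w ∷ []))
                     (subst (λ p → col (G · p) u ≡ white) (++-assoc pre (u ∷ []) (w ∷ [])) u-white′)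

  legalBlocks-unique : ∀ pre (ps bs : List (Block n)) → LegalBlocks G pre ps → ValidBlocks G pre bs →
    AllPairs Disjoint (map letters bs) → concatMap letters ps ≡ concatMap letters bs → ps ≡ bs
  legalBlocks-unique pre [] [] _ _ _ _ = refl
  legalBlocks-unique pre [] (single u ∷ bs)   _ _ _ ()
  legalBlocks-unique pre [] (triple u v ∷ bs) _ _ _ ()
  legalBlocks-unique pre (single w ∷ ps)   [] _ _ _ ()
  legalBlocks-unique pre (triple w z ∷ ps) [] _ _ _ ()
  legalBlocks-unique pre (single w ∷ ps) (single u ∷ bs) (_ , ls) vb (_ ∷ d) e with ∷-injectiveˡ e
  ... | refl = cong (single w ∷_) (legalBlocks-unique (pre ++ w ∷ []) ps bs ls vb d (∷-injectiveʳ e))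
  legalBlocks-unique pre (triple w z ∷ ps) (single u ∷ bs) _ _ (d ∷ _) e with ∷-injectiveˡ e
  ... | refl = ⊥-elim (∉-concatMap bs d (here refl) (subst (w ∈_) (∷-injectiveʳ e) (there (here refl))))
  legalBlocks-unique pre (triple w z ∷ ps) (triple u v ∷ bs) (_ , ls) (_ , vb) (_ ∷ d) e
    with ∷-injectiveˡ e | ∷-injectiveˡ (∷-injectiveʳ e)
  ... | refl | refl = cong (triple w z ∷_)
    (legalBlocks-unique (pre ++ w ∷ z ∷ w ∷ []) ps bs ls vb d (∷-injectiveʳ (∷-injectiveʳ (∷-injectiveʳ e))))
  legalBlocks-unique pre (single w ∷ ps) (triple u v ∷ bs) (u-white , ls) (uv , _) (d ∷ _) e with ∷-injectiveˡ e
  ... | refl = ⊥-elim (no-split-triple pre w v ps bs u-white uv d ls (∷-injectiveʳ e))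

Distinct : ∀ {n} → Block n → Set
Distinct (single u)   = ⊤
Distinct (triple u v) = u ≢ v

validBlocks-distinct : ∀ {n} {G : BGraph n} → Simple G → ∀ pre bs → ValidBlocks G pre bs → All Distinct bs
validBlocks-distinct s pre []                _          = []
validBlocks-distinct s pre (single u ∷ bs)   vb         = tt ∷ validBlocks-distinct s (pre ++ u ∷ []) bs vb
validBlocks-distinct s pre (triple u v ∷ bs) (uv , vb) =
  adjacent⇒≢ (·-simple s pre) uv ∷ validBlocks-distinct s (pre ++ u ∷ v ∷ u ∷ []) bs vb

mask-∉ : ∀ {n} (b : Block n) {x} → x ∉ letters b → mask b x ≡ false
mask-∉ (single u)   x∉ = δ-≢ (x∉ ∘ here)
mask-∉ (triple u v) x∉ = cong₂ _xor_ (δ-≢ (x∉ ∘ here)) (δ-≢ (x∉ ∘ there ∘ here))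

mask-∈ : ∀ {n} (b : Block n) {x} → Distinct b → x ∈ letters b → mask b x ≡ true
mask-∈ (single u)   _   (here refl)                 = δ-refl u
mask-∈ (triple u v) u≢v (here refl)                 = cong₂ _xor_ (δ-refl u) (δ-≢ u≢v)
mask-∈ (triple u v) u≢v (there (here refl))         = cong₂ _xor_ (δ-≢ (u≢v ∘ sym)) (δ-refl v)
mask-∈ (triple u v) u≢v (there (there (here refl))) = cong₂ _xor_ (δ-refl u) (δ-≢ u≢v)

mask-true⇒∈ : ∀ {n} (b : Block n) {x} → mask b x ≡ true → x ∈ letters b
mask-true⇒∈ (single u)   e = here (δ⇒≡ e)
mask-true⇒∈ (triple u v) {x} e with x ≟ u | x ≟ v
... | yes x≡u | _       = here x≡u
... | no _    | yes x≡v = there (here x≡v)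
mask-true⇒∈ (triple u v) () | no _ | no _

masks-∉ : ∀ {n} (bs : List (Block n)) {x} → x ∉ concatMap letters bs → masks bs x ≡ false
masks-∉ []       x∉ = refl
masks-∉ (b ∷ bs) x∉ = cong₂ _xor_ (mask-∉ b (x∉ ∘ ∈-++⁺ˡ)) (masks-∉ bs (x∉ ∘ ∈-++⁺ʳ (letters b)))

masks-∈ : ∀ {n} (bs : List (Block n)) {x} → All Distinct bs → AllPairs Disjoint (map letters bs) →
  x ∈ concatMap letters bs → masks bs x ≡ true
masks-∈ (b ∷ bs) (t ∷ ts) (d ∷ ds) x∈ with ∈-++⁻ (letters b) x∈
... | inj₁ x∈b  = cong₂ _xor_ (mask-∈ b t x∈b) (masks-∉ bs (∉-concatMap bs d x∈b))
... | inj₂ x∈bs = cong₂ _xor_ (mask-∉ b (λ x∈b → ∉-concatMap bs d x∈b x∈bs)) (masks-∈ bs ts ds x∈bs)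

masks-true⇒∈ : ∀ {n} (bs : List (Block n)) {x} → masks bs x ≡ true → x ∈ concatMap letters bs
masks-true⇒∈ (b ∷ bs) {x} e with mask b x in mb
... | true  = ∈-++⁺ˡ (mask-true⇒∈ b mb)
... | false = ∈-++⁺ʳ (letters b) (masks-true⇒∈ bs e)

invertingWord-inverse : ∀ {n} {G : BGraph n} → Simple G → ∀ {s} → InvertingWord G s →
  ∀ a x → apply (G · s) (apply G a) x ≡ a x
invertingWord-inverse {G = G} s {w} (P , (bs , e , d , vb) , all) with parity⇒legalParsing s P
... | ps , e′ , ls = subst (λ w → ∀ a x → apply (G · w) (apply G a) x ≡ a x) e′
                           (⇄-mask {m′ = λ _ → true} covers (legalBlocks-⇄ s [] ps ls))
  where
  ps≡bs : ps ≡ bs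
  ps≡bs = legalBlocks-unique s [] ps bs ls vb d (trans e′ (sym e))
  covers : ∀ x → masks ps x ≡ true
  covers x = subst (λ qs → masks qs x ≡ true) (sym ps≡bs)
    (masks-∈ bs (validBlocks-distinct s [] bs vb) d (subst (x ∈_) (sym e) (all x)))

-- Undoing local complementations and pivots

infix 4 _≈ᴳ_
_≈ᴳ_ : ∀ {n} → BGraph n → BGraph n → Set
H ≈ᴳ K = (∀ x y → adj H x y ≡ adj K x y) × (∀ x → col H x ≡ col K x)

≈ᴳ-trans : ∀ {n} {H K L : BGraph n} → H ≈ᴳ K → K ≈ᴳ L → H ≈ᴳ L
≈ᴳ-trans (a₁ , c₁) (a₂ , c₂) = (λ x y → trans (a₁ x y) (a₂ x y)) , (λ x → trans (c₁ x) (c₂ x))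

apply-≈ᴳ : ∀ {n} {H K : BGraph n} → H ≈ᴳ K → ∀ c x → apply H c x ≡ apply K c x
apply-≈ᴳ (a , cl) c x =
  ⊕-sum-cong (λ y → cong (_∧ c y) (cong₂ (λ w e → if δ x y then isWhite w else e) (cl x) (a x y)))

lc-col : ∀ {n} (H : BGraph n) u x → col (lc H u) x ≡ (if isWhite (col H u) then flipIf (adj H u x) (col H x) else col H x)
lc-col H u x with col H u
... | white = refl
... | black = refl

lc-cong : ∀ {n} {H K : BGraph n} u → H ≈ᴳ K → lc H u ≈ᴳ lc K u
lc-cong {H = H} {K} u (a , c) =
  (λ x y → cong₂ (λ p q → p xor (not (δ x y) ∧ q)) (a x y) (cong₂ _∧_ (a u x) (a u y))) ,
  (λ x → trans (lc-col H u x) (trans (cong₃ (c u) (a u x) (c x)) (sym (lc-col K u x))))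
  where
  cong₃ : ∀ {w w′ p p′ k k′} → w ≡ w′ → p ≡ p′ → k ≡ k′ →
    (if isWhite w then flipIf p k else k) ≡ (if isWhite w′ then flipIf p′ k′ else k′)
  cong₃ refl refl refl = refl

lc-involutive : ∀ {n} {H : BGraph n} → Simple H → ∀ u → lc (lc H u) u ≈ᴳ H
lc-involutive {H = H} s u = adjacency , colour
  where
  adjacency : ∀ x y → adj (lc (lc H u) u) x y ≡ adj H x y
  adjacency x y =
    trans (cong₂ (λ p q → adj (lc H u) x y xor (not (δ x y) ∧ (p ∧ q))) (lc-adj-self s u x) (lc-adj-self s u y))
          (cancel (adj H x y) (not (δ x y) ∧ (adj H u x ∧ adj H u y)))
    where
    cancel : ∀ a t → (a xor t) xor t ≡ a
    cancel = solve-∀ boolRing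
  flip-flip : ∀ b c → flipIf b (flipIf b c) ≡ c
  flip-flip false c     = refl
  flip-flip true  white = refl
  flip-flip true  black = refl
  colour : ∀ x → col (lc (lc H u) u) x ≡ col H x
  colour x = by-colour (col H u) refl
    where
    by-colour : ∀ k → col H u ≡ k → col (lc (lc H u) u) x ≡ col H x
    by-colour black u-col =
      trans (lc-black-col (lc H u) (trans (lc-black-col H u-col u) u-col) x) (lc-black-col H u-col x)
    by-colour white u-col =
      trans (lc-white-col (lc H u) (trans (lc-white-col H u-col u) (cong₂ flipIf (loopless s u) u-col)) x)
            (trans (cong₂ flipIf (lc-adj-self s u x) (lc-white-col H u-col x)) (flip-flip (adj H u x) (col H x)))

lc-white-⇄⁻¹ : ∀ {n} {H : BGraph n} {u} → Simple H → col H u ≡ white → lc H u ⇄⟨ mask (single u) ⟩ H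
lc-white-⇄⁻¹ {H = H} {u} s u-white =
  ⇄-resp (apply-≈ᴳ (lc-involutive s u))
         (lc-white-⇄ (lc-simple u s) (trans (lc-white-col H u-white u) (cong₂ flipIf (loopless s u) u-white)))

pivot-⇄⁻¹ : ∀ {n} {H : BGraph n} {u v} → Simple H → adj H u v ≡ true →
  col H u ≡ black → col H v ≡ black → H · (u ∷ v ∷ u ∷ []) ⇄⟨ mask (triple u v) ⟩ H
pivot-⇄⁻¹ {H = H} {u} {v} s uv u-black v-black =
  ⇄-resp (apply-≈ᴳ back) (pivot-⇄ s₃ uv₃ (trans (col₃ u) u-black) (trans (col₃ v) v-black))
  where
  open Pivot s uv u-black v-black using (H₁; H₂; s₂; v-black₁; u-black₂; t-v)
  H₃ = lc H₂ u
  col₃ : ∀ y → col H₃ y ≡ col H y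
  col₃ y = trans (lc-black-col H₂ u-black₂ y) (trans (lc-black-col H₁ v-black₁ y) (lc-black-col H u-black y))
  s₃ = lc-simple u s₂
  uv₃ : adj H₃ u v ≡ true
  uv₃ = trans (lc-adj-self s₂ u v) t-v
  back : lc (lc (lc H₃ u) v) u ≈ᴳ H
  back = ≈ᴳ-trans (lc-cong u (≈ᴳ-trans (lc-cong v (lc-involutive s₂ u)) (lc-involutive (lc-simple u s) v)))
                  (lc-involutive s u)

legal-⇄⁻¹ : ∀ {n} {G : BGraph n} → Simple G → ∀ pre b → Legal G pre b → G · (pre ++ letters b) ⇄⟨ mask b ⟩ G · pre
legal-⇄⁻¹ {G = G} s pre (single u) u-white =
  subst (_⇄⟨ mask (single u) ⟩ G · pre) (sym (·-++ G pre (u ∷ []))) (lc-white-⇄⁻¹ (·-simple s pre) u-white)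
legal-⇄⁻¹ {G = G} s pre (triple u v) (uv , u-black , v-black) =
  subst (_⇄⟨ mask (triple u v) ⟩ G · pre) (sym (·-++ G pre (u ∷ v ∷ u ∷ [])))
        (pivot-⇄⁻¹ (·-simple s pre) uv u-black v-black)

-- Graphs with nonsingular matrix are invertible

Nonsingular : ∀ {n} → BGraph n → Set
Nonsingular G = ∀ a → (∀ x → apply G a x ≡ false) → ∀ z → a z ≡ false

-- If every neighbour of r were covered, the exchange identity applied to the unit
-- vector at r would exhibit a vector in the kernel of G that is nonzero at r.
uncovered-neighbour : ∀ {n} {G H : BGraph n} {m r} → Simple H → Nonsingular G → H ⇄⟨ m ⟩ G →
  m r ≡ false → col H r ≡ black → ∃ λ v → m v ≡ false × adj H r v ≡ true
uncovered-neighbour {G = G} {H} {m} {r} s nonsingular HG r-free r-black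
  with any? (λ v → (m v Bool.≟ false) ×-dec (adj H r v Bool.≟ true))
... | yes found = found
... | no  none  = contradiction (nonsingular a vanishes r) a-r
  where
  e : Fin _ → Bool
  e y = δ y r
  a = select m e (apply H e)
  a-r : a r ≢ false
  a-r a-r≡false rewrite r-free | δ-refl r with a-r≡false
  ... | ()
  vanishes : ∀ x → apply G a x ≡ false
  vanishes x = trans (HG e x) (by-cover (m x) refl)
    where
    by-cover : ∀ k → m x ≡ k → select m (apply H e) e x ≡ false
    by-cover true  m-x rewrite m-x = δ-≢ (λ { refl → contradiction (trans (sym m-x) r-free) λ () })
    by-cover false m-x rewrite m-x = trans (apply-δ H r x) (by-vertex (x ≟ r))
      where
      by-vertex : Dec (x ≡ r) → matrix H x r ≡ false
      by-vertex (yes refl) = trans (matrix-diag H x) (cong isWhite r-black)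
      by-vertex (no x≢r)   = trans (matrix-≢ H x≢r) (trans (symmetric s x r) (not-adjacent (adj H r x) refl))
        where
        not-adjacent : ∀ b → adj H r x ≡ b → b ≡ false
        not-adjacent false _ = refl
        not-adjacent true  e = contradiction (x , m-x , e) none

parity-snoc : ∀ {n} {G : BGraph n} {w} b → Parity G w → Legal G w b → Parity G (w ++ letters b)
parity-snoc (single u)   P u-white                   = pw-white P u-white
parity-snoc (triple u v) P (uv , u-black , v-black) = pw-black P uv u-black v-black

ValidBlock : ∀ {n} → BGraph n → List (Fin n) → Block n → Set
ValidBlock G w (single u)   = ⊤
ValidBlock G w (triple u v) = adj (G · w) u v ≡ true

legal⇒valid : ∀ {n} {G : BGraph n} {w} b → Legal G w b → ValidBlock G w b
legal⇒valid (single u)   _        = tt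
legal⇒valid (triple u v) (uv , _) = uv

validBlocks-snoc : ∀ {n} (G : BGraph n) pre bs b →
  ValidBlocks G pre bs → ValidBlock G (pre ++ concatMap letters bs) b → ValidBlocks G pre (bs ++ b ∷ [])
validBlocks-snoc G pre [] (single u)   _ _  = tt
validBlocks-snoc G pre [] (triple u v) _ uv = subst (λ w → adj (G · w) u v ≡ true) (++-identityʳ pre) uv , tt
validBlocks-snoc G pre (single u ∷ bs) b vb valid =
  validBlocks-snoc G (pre ++ u ∷ []) bs b vb (subst (λ w → ValidBlock G w b) (sym (++-assoc pre (u ∷ []) _)) valid)
validBlocks-snoc G pre (triple u v ∷ bs) b (uv , vb) valid =
  uv , validBlocks-snoc G (pre ++ u ∷ v ∷ u ∷ []) bs b vb
         (subst (λ w → ValidBlock G w b) (sym (++-assoc pre (u ∷ v ∷ u ∷ []) _)) valid)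

record Progress {n} (G : BGraph n) : Set where
  field
    word     : List (Fin n)
    parity   : Parity G word
    blocks   : List (Block n)
    spells   : concatMap letters blocks ≡ word
    disjoint : AllPairs Disjoint (map letters blocks)
    valid    : ValidBlocks G [] blocks
    back     : G · word ⇄⟨ masks blocks ⟩ G
open Progress

module _ {n} {G : BGraph n} (s : Simple G) where

  start : Progress G
  start = record { word = [] ; parity = pw-nil ; blocks = [] ; spells = refl ; disjoint = [] ; valid = tt
                 ; back = ⇄-refl G }

  covered : Progress G → Fin n → Bool
  covered p = masks (blocks p)

  covered-∈ : ∀ p {x} → x ∈ word p → covered p x ≡ true
  covered-∈ p x∈ = masks-∈ (blocks p) (validBlocks-distinct s [] (blocks p) (valid p)) (disjoint p)
                           (subst (_ ∈_) (sym (spells p)) x∈)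

  Fresh : Progress G → Block n → Set
  Fresh p b = ∀ x → x ∈ letters b → covered p x ≡ false

  extend : ∀ p b → Legal G (word p) b → Fresh p b → Progress G
  extend p b legal fresh = record
    { word     = word p ++ letters b
    ; parity   = parity-snoc b (parity p) legal
    ; blocks   = blocks p ++ b ∷ []
    ; spells   = trans (concatMap-snoc (blocks p) b) (cong (_++ letters b) (spells p))
    ; disjoint = subst (AllPairs Disjoint) (sym (map-++ letters (blocks p) (b ∷ [])))
                       (AllPairs.++⁺ (disjoint p) ([] ∷ []) (apart (blocks p) clash))
    ; valid    = validBlocks-snoc G [] (blocks p) b (valid p)
                   (subst (λ w → ValidBlock G w b) (sym (spells p)) (legal⇒valid b legal))
    ; back     = ⇄-mask (λ x → sym (masks-snoc (blocks p) b x)) (⇄-trans (legal-⇄⁻¹ s (word p) b legal) (back p))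
    }
    where
    true≢false : true ≢ false
    true≢false ()
    clash : ∀ {z} → z ∈ concatMap letters (blocks p) → z ∉ letters b
    clash z∈ z∈b = true≢false (trans (sym (covered-∈ p (subst (_ ∈_) (spells p) z∈))) (fresh _ z∈b))
    apart : ∀ bs → (∀ {z} → z ∈ concatMap letters bs → z ∉ letters b) →
            All (λ l → All (Disjoint l) (letters b ∷ [])) (map letters bs)
    apart []       _ = []
    apart (c ∷ bs) f = ((λ (z∈c , z∈b) → f (∈-++⁺ˡ z∈c) z∈b) ∷ []) ∷ apart bs (f ∘ ∈-++⁺ʳ (letters c))

  Grows : Progress G → Progress G → Set
  Grows p q = ∀ x → covered p x ≡ true → covered q x ≡ true

  extend-grows : ∀ p b legal fresh → Grows p (extend p b legal fresh)
  extend-grows p b legal fresh x x-cov =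
    trans (masks-snoc (blocks p) b x) (cong₂ _xor_ (mask-∉ b x∉b) x-cov)
    where
    x∉b : x ∉ letters b
    x∉b x∈b with trans (sym x-cov) (fresh x x∈b)
    ... | ()

  extend-covers : ∀ p b legal fresh → ∀ {x} → x ∈ letters b → covered (extend p b legal fresh) x ≡ true
  extend-covers p b legal fresh x∈b = covered-∈ (extend p b legal fresh) (∈-++⁺ʳ (word p) x∈b)

  -- An uncovered white r is taken alone.  An uncovered black r has an uncovered
  -- neighbour v: pivot on rv if v is black; otherwise take v, which turns r white, then r.
  cover : Nonsingular G → ∀ p r → Σ (Progress G) λ q → Grows p q × covered q r ≡ true
  cover nonsingular p r with covered p r in r-cov
  ... | true  = p , (λ _ e → e) , r-cov
  ... | false with col (G · word p) r in r-col
  ...   | white = extend p (single r) r-col fresh-r , extend-grows p _ r-col fresh-r , extend-covers p _ r-col fresh-r (here refl)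
    where
    fresh-r : Fresh p (single r)
    fresh-r x (here refl) = r-cov
  ...   | black with uncovered-neighbour (·-simple s (word p)) nonsingular (back p) r-cov r-col
  ...     | v , v-cov , rv with col (G · word p) v in v-col
  ...       | black = extend p (triple r v) legal fresh , extend-grows p _ legal fresh , extend-covers p _ legal fresh (here refl)
    where
    legal : Legal G (word p) (triple r v)
    legal = rv , r-col , v-col
    fresh : Fresh p (triple r v)
    fresh x (here refl)                 = r-cov
    fresh x (there (here refl))         = v-cov
    fresh x (there (there (here refl))) = r-cov
  ...       | white = q , (λ x → extend-grows q₁ _ r-white fresh-r x ∘ extend-grows p _ v-col fresh-v x) ,
                      extend-covers q₁ _ r-white fresh-r (here refl)
    where
    fresh-v : Fresh p (single v)
    fresh-v x (here refl) = v-cov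
    q₁ = extend p (single v) v-col fresh-v
    r-white : col (G · (word p ++ v ∷ [])) r ≡ white
    r-white = subst (λ H → col H r ≡ white) (sym (·-++ G (word p) (v ∷ [])))
      (trans (lc-white-col (G · word p) v-col r)
             (cong₂ flipIf (trans (symmetric (·-simple s (word p)) v r) rv) r-col))
    fresh-r : Fresh q₁ (single r)
    fresh-r x (here refl) = trans (masks-snoc (blocks p) (single v) r) (cong₂ _xor_ (δ-≢ (adjacent⇒≢ (·-simple s (word p)) rv)) r-cov)
    q = extend q₁ (single r) r-white fresh-r

  cover-all : Nonsingular G → ∀ (L : List (Fin n)) p → (∀ x → x ∈ L ⊎ covered p x ≡ true) →
    Σ (Progress G) λ q → ∀ x → covered q x ≡ true
  cover-all nonsingular [] p rest = p , λ x → by-rest (rest x)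
    where
    by-rest : ∀ {x} → x ∈ [] ⊎ covered p x ≡ true → covered p x ≡ true
    by-rest (inj₂ e) = e
  cover-all nonsingular (r ∷ L) p rest with cover nonsingular p r
  ... | q , grows , r-cov = cover-all nonsingular L q rest′
    where
    rest′ : ∀ x → x ∈ L ⊎ covered q x ≡ true
    rest′ x with rest x
    ... | inj₁ (here refl) = inj₂ r-cov
    ... | inj₁ (there x∈L) = inj₁ x∈L
    ... | inj₂ x-cov       = inj₂ (grows x x-cov)

invertible-if-nonsingular : ∀ {n} {G : BGraph n} → Simple G → Nonsingular G → Invertible G
invertible-if-nonsingular {n} s nonsingular with cover-all s nonsingular (allFin n) (start s) (λ x → inj₁ (∈-allFin x))
... | q , all = word q , parity q , (blocks q , spells q , disjoint q , valid q) ,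
                λ x → subst (x ∈_) (spells q) (masks-true⇒∈ (blocks q) (all x))

invertible⇒nonsingular : ∀ {n} {G : BGraph n} → Simple G → Invertible G → Nonsingular G
invertible⇒nonsingular {n} {G} s (w , iw) a Ga≡0 z = begin
  a z                                   ≡⟨ sym (invertingWord-inverse s iw a z) ⟩
  apply (G · w) (apply G a) z           ≡⟨ apply-cong (G · w) Ga≡0 z ⟩
  apply (G · w) (λ _ → false) z         ≡⟨ ⊕-sum-cong (λ y → ∧-zeroʳ (matrix (G · w) z y)) ⟩
  ⊕-sum {n} (λ _ → false)               ≡⟨ ⊕-sum-false n ⟩
  false                                 ∎

RightInverse : ∀ {n} → BGraph n → (Fin n → Fin n → Bool) → Set
RightInverse G C = ∀ z x → apply G (λ y → C y z) x ≡ δ x z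

rightInverse⇒nonsingular : ∀ {n} {G : BGraph n} {C} → Simple G → RightInverse G C → Nonsingular G
rightInverse⇒nonsingular {n} {G} {C} s GC a Ga≡0 z = begin
  a z                                                  ≡⟨ sym (⊕-sum-δ z a) ⟩
  ⊕-sum (λ x → δ x z ∧ a x)                            ≡⟨ ⊕-sum-cong (λ x → cong (_∧ a x) (sym (GC z x))) ⟩
  ⊕-sum (λ x → apply G (λ y → C y z) x ∧ a x)          ≡⟨ ⊕-sum-cong (λ x → sym (⊕-sum-∧ʳ (λ y → matrix G x y ∧ C y z) (a x))) ⟩
  ⊕-sum (λ x → ⊕-sum (λ y → (matrix G x y ∧ C y z) ∧ a x)) ≡⟨ ⊕-sum-swap (λ x y → (matrix G x y ∧ C y z) ∧ a x) ⟩
  ⊕-sum (λ y → ⊕-sum (λ x → (matrix G x y ∧ C y z) ∧ a x)) ≡⟨ ⊕-sum-cong regroup ⟩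
  ⊕-sum (λ y → C y z ∧ apply G a y)                    ≡⟨ ⊕-sum-cong (λ y → trans (cong (C y z ∧_) (Ga≡0 y)) (∧-zeroʳ (C y z))) ⟩
  ⊕-sum {n} (λ _ → false)                              ≡⟨ ⊕-sum-false n ⟩
  false                                                ∎
  where
  regroup : ∀ y → ⊕-sum (λ x → (matrix G x y ∧ C y z) ∧ a x) ≡ C y z ∧ apply G a y
  regroup y = trans (⊕-sum-cong (λ x → trans (cong (λ m → (m ∧ C y z) ∧ a x) (matrix-sym s x y)) (rearrange (matrix G y x) (C y z) (a x))))
                    (⊕-sum-∧ˡ (C y z) (λ x → matrix G y x ∧ a x))
    where
    rearrange : ∀ m c a → (m ∧ c) ∧ a ≡ c ∧ (m ∧ a)
    rearrange = solve-∀ boolRing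

leftInverse-unique : ∀ {n} {G X : BGraph n} {C} → RightInverse G C →
  (∀ a x → apply X (apply G a) x ≡ a x) → ∀ x z → matrix X x z ≡ C x z
leftInverse-unique {G = G} {X} {C} GC XG x z =
  trans (sym (apply-δ X z x))
        (trans (⊕-sum-cong (λ y → cong (matrix X x y ∧_) (sym (GC z y)))) (XG (λ y → C y z) x))

-- Residues modulo n

module Residues (N : ℕ) where
  private
    n = suc N

  sub : ℕ → ℕ → ℕ
  sub a c = (a + (n ∸ c)) % n

  next : ℕ → ℕ
  next k = suc k % n

  prev : ℕ → ℕ
  prev k = (N + k) % n

  neg : ℕ → ℕ
  neg k = (n ∸ k) % n

  %-absorbˡ : ∀ a b → (a % n + b) % n ≡ (a + b) % n
  %-absorbˡ a b = begin
    (a % n + b) % n         ≡⟨ %-distribˡ-+ (a % n) b n ⟩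
    (a % n % n + b % n) % n ≡⟨ cong (λ z → (z + b % n) % n) (m%n%n≡m%n a n) ⟩
    (a % n + b % n) % n     ≡⟨ sym (%-distribˡ-+ a b n) ⟩
    (a + b) % n             ∎

  %-absorbʳ : ∀ a b → (a + b % n) % n ≡ (a + b) % n
  %-absorbʳ a b = begin
    (a + b % n) % n ≡⟨ cong (_% n) (+-comm a (b % n)) ⟩
    (b % n + a) % n ≡⟨ %-absorbˡ b a ⟩
    (b + a) % n     ≡⟨ cong (_% n) (+-comm b a) ⟩
    (a + b) % n     ∎

  +-cancel-n : ∀ a k → k ≤ n → a < n → ((a + k) + (n ∸ k)) % n ≡ a
  +-cancel-n a k k≤n a<n = begin
    ((a + k) + (n ∸ k)) % n ≡⟨ cong (_% n) (+-assoc a k (n ∸ k)) ⟩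
    (a + (k + (n ∸ k))) % n ≡⟨ cong (λ z → (a + z) % n) (m+[n∸m]≡n k≤n) ⟩
    (a + n) % n             ≡⟨ [m+n]%n≡m%n a n ⟩
    a % n                   ≡⟨ m<n⇒m%n≡m a<n ⟩
    a                       ∎

  sub<n : ∀ a c → sub a c < n
  sub<n a c = m%n<n (a + (n ∸ c)) n

  add-sub : ∀ a c → a < n → c < n → (c + sub a c) % n ≡ a
  add-sub a c a<n c<n = begin
    (c + (a + (n ∸ c)) % n) % n ≡⟨ %-absorbʳ c (a + (n ∸ c)) ⟩
    (c + (a + (n ∸ c))) % n     ≡⟨ cong (_% n) (trans (sym (+-assoc c a _)) (cong (_+ (n ∸ c)) (+-comm c a))) ⟩
    ((a + c) + (n ∸ c)) % n     ≡⟨ +-cancel-n a c (<⇒≤ c<n) a<n ⟩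
    a                           ∎

  sub-unique : ∀ a c d → d < n → a < n → (a + d) % n ≡ c → sub c a ≡ d
  sub-unique a c d d<n a<n e = begin
    (c + (n ∸ a)) % n             ≡⟨ cong (λ z → (z + (n ∸ a)) % n) (sym e) ⟩
    ((a + d) % n + (n ∸ a)) % n   ≡⟨ %-absorbˡ (a + d) (n ∸ a) ⟩
    ((a + d) + (n ∸ a)) % n       ≡⟨ cong (λ z → (z + (n ∸ a)) % n) (+-comm a d) ⟩
    ((d + a) + (n ∸ a)) % n       ≡⟨ +-cancel-n d a (<⇒≤ a<n) d<n ⟩
    d                             ∎

  sub-self : ∀ a → a < n → sub a a ≡ 0
  sub-self a a<n = sub-unique a a 0 (s≤s z≤n) a<n (trans (cong (_% n) (+-identityʳ a)) (m<n⇒m%n≡m a<n))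

  sub-injectiveˡ : ∀ a a′ c → a < n → a′ < n → c < n → sub a c ≡ sub a′ c → a ≡ a′
  sub-injectiveˡ a a′ c a<n a′<n c<n e =
    trans (sym (add-sub a c a<n c<n)) (trans (cong (λ z → (c + z) % n) e) (add-sub a′ c a′<n c<n))

  sub≡0⇒≡ : ∀ a c → a < n → c < n → sub a c ≡ 0 → a ≡ c
  sub≡0⇒≡ a c a<n c<n e = sub-injectiveˡ a c c a<n c<n c<n (trans e (sym (sub-self c c<n)))

  sub-next : ∀ a c → sub (next a) c ≡ next (sub a c)
  sub-next a c = begin
    (suc a % n + (n ∸ c)) % n   ≡⟨ %-absorbˡ (suc a) (n ∸ c) ⟩
    (suc a + (n ∸ c)) % n       ≡⟨ sym (%-absorbʳ 1 (a + (n ∸ c))) ⟩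
    suc ((a + (n ∸ c)) % n) % n ∎

  sub-prev : ∀ a c → sub (prev a) c ≡ prev (sub a c)
  sub-prev a c = begin
    ((N + a) % n + (n ∸ c)) % n ≡⟨ %-absorbˡ (N + a) (n ∸ c) ⟩
    ((N + a) + (n ∸ c)) % n     ≡⟨ cong (_% n) (+-assoc N a _) ⟩
    (N + (a + (n ∸ c))) % n     ≡⟨ sym (%-absorbʳ N (a + (n ∸ c))) ⟩
    (N + (a + (n ∸ c)) % n) % n ∎

  n+a%n : ∀ a → a < n → (n + a) % n ≡ a
  n+a%n a a<n = trans (cong (_% n) (+-comm n a)) (trans ([m+n]%n≡m%n a n) (m<n⇒m%n≡m a<n))

  next-prev : ∀ a → a < n → next (prev a) ≡ a
  next-prev a a<n = trans (%-absorbʳ 1 (N + a)) (n+a%n a a<n)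

  prev-next : ∀ a → a < n → prev (next a) ≡ a
  prev-next a a<n = trans (%-absorbʳ N (suc a)) (trans (cong (_% n) (+-suc N a)) (n+a%n a a<n))

  sub-swap : ∀ a c → a < n → c < n → sub c a ≡ neg (sub a c)
  sub-swap a c a<n c<n = sub-unique a c (neg k) (m%n<n (n ∸ k) n) a<n (begin
    (a + (n ∸ k) % n) % n       ≡⟨ %-absorbʳ a (n ∸ k) ⟩
    (a + (n ∸ k)) % n           ≡⟨ cong (λ z → (z + (n ∸ k)) % n) (sym (add-sub a c a<n c<n)) ⟩
    ((c + k) % n + (n ∸ k)) % n ≡⟨ %-absorbˡ (c + k) (n ∸ k) ⟩
    ((c + k) + (n ∸ k)) % n     ≡⟨ +-cancel-n c k (<⇒≤ (sub<n a c)) c<n ⟩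
    c                           ∎)
    where
    k = sub a c

-- The cycle C_n

δ-≡-does : ∀ {n} {x y : Fin n} {P : Set} (p? : Dec P) → x ≡ y ⇔ P → δ x y ≡ does p?
δ-≡-does {x = x} {y} p? x≡y⇔P = trans (isYes≗does (x ≟ y)) (does-⇔ x≡y⇔P (x ≟ y) p?)

isOdd : ℕ → Bool
isOdd zero    = false
isOdd (suc k) = not (isOdd k)

even≡not-isOdd : ∀ k → (k % 2 ≡ᵇ 0) ≡ not (isOdd k)
even≡not-isOdd zero          = refl
even≡not-isOdd (suc zero)    = refl
even≡not-isOdd (suc (suc k)) = trans (even≡not-isOdd k) (cong not (sym (not-involutive (isOdd k))))

isOdd-count : ∀ {m k} (f : Fin m → Bool) (g : Fin k → Fin m) →
  isOdd (sum (map (λ y → if f y then 1 else 0) (tabulate g))) ≡ ⊕-sum (f ∘ g)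
isOdd-count {k = zero}  f g = refl
isOdd-count {k = suc k} f g with f (g zero)
... | true  = cong not (isOdd-count f (g ∘ suc))
... | false = isOdd-count f (g ∘ suc)

degree-parity : ∀ {m} (a : Fin m → Fin m → Bool) x → (degree a x % 2 ≡ᵇ 0) ≡ not (⊕-sum (a x))
degree-parity a x = trans (even≡not-isOdd (degree a x)) (cong not (isOdd-count (a x) (λ i → i)))

∨≡xor : ∀ a b → (a ≡ true → b ≡ true → ⊥) → a ∨ b ≡ a xor b
∨≡xor false b    _ = refl
∨≡xor true false _ = refl
∨≡xor true true  f = contradiction refl (f refl)

module Cycle (N : ℕ) (N≥2 : 2 ≤ N) where
  open Residues N public

  private
    n = suc N

  1<n : 1 < n
  1<n = s≤s (ℕ.≤-trans (s≤s z≤n) N≥2)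

  nextF : Fin n → Fin n
  nextF x = fromℕ< (m%n<n (suc (toℕ x)) n)

  prevF : Fin n → Fin n
  prevF x = fromℕ< (m%n<n (N + toℕ x) n)

  toℕ-nextF : ∀ x → toℕ (nextF x) ≡ next (toℕ x)
  toℕ-nextF x = toℕ-fromℕ< (m%n<n (suc (toℕ x)) n)

  toℕ-prevF : ∀ x → toℕ (prevF x) ≡ prev (toℕ x)
  toℕ-prevF x = toℕ-fromℕ< (m%n<n (N + toℕ x) n)

  diff-self : ∀ x → diff x x ≡ 0
  diff-self x = sub-self (toℕ x) (toℕ<n x)

  sub-next-self : ∀ a → a < n → sub (next a) a ≡ 1
  sub-next-self a a<n = trans (sub-next a a) (trans (cong next (sub-self a a<n)) (m<n⇒m%n≡m 1<n))

  δ-diff : ∀ x y → δ x y ≡ (diff x y ≡ᵇ 0)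
  δ-diff x y = δ-≡-does (diff x y ℕ.≟ 0) (mk⇔ (λ { refl → diff-self x })
    (λ e → toℕ-injective (sub≡0⇒≡ (toℕ x) (toℕ y) (toℕ<n x) (toℕ<n y) e)))

  δ-nextF : ∀ x y → δ y (nextF x) ≡ (diff y x ≡ᵇ 1)
  δ-nextF x y = δ-≡-does (diff y x ℕ.≟ 1) (mk⇔
    (λ { refl → trans (cong (λ z → sub z (toℕ x)) (toℕ-nextF x)) (sub-next-self (toℕ x) (toℕ<n x)) })
    (λ e → toℕ-injective (trans (sub-injectiveˡ (toℕ y) (next (toℕ x)) (toℕ x) (toℕ<n y) (m%n<n (suc (toℕ x)) n) (toℕ<n x)
                                   (trans e (sym (sub-next-self (toℕ x) (toℕ<n x)))))
                                (sym (toℕ-nextF x)))))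

  δ-prevF : ∀ x y → δ y (prevF x) ≡ (diff x y ≡ᵇ 1)
  δ-prevF x y = δ-≡-does (diff x y ℕ.≟ 1) (mk⇔
    (λ { refl → trans (cong (sub (toℕ x)) (toℕ-prevF x))
                  (trans (cong (λ z → sub z (prev (toℕ x))) (sym (next-prev (toℕ x) (toℕ<n x))))
                         (sub-next-self (prev (toℕ x)) (m%n<n (N + toℕ x) n))) })
    (λ e → toℕ-injective (trans (sym (prev-next (toℕ y) (toℕ<n y)))
      (trans (cong prev (sym (sub-injectiveˡ (toℕ x) (next (toℕ y)) (toℕ y) (toℕ<n x) (m%n<n (suc (toℕ y)) n) (toℕ<n y)
                                (trans e (sym (sub-next-self (toℕ y) (toℕ<n y)))))))
             (sym (toℕ-prevF x))))))

  -- For n ≥ 3 the two neighbours x ± 1 are distinct, so `or` in `cay` becomes `xor`.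
  cycle-adj : ∀ x y → cay n (λ k → k ≡ᵇ 1) x y ≡ δ y (nextF x) xor δ y (prevF x)
  cycle-adj x y =
    trans (∨≡xor (diff x y ≡ᵇ 1) (diff y x ≡ᵇ 1) both)
          (trans (xor-comm (diff x y ≡ᵇ 1) (diff y x ≡ᵇ 1)) (sym (cong₂ _xor_ (δ-nextF x y) (δ-prevF x y))))
    where
    both : (diff x y ≡ᵇ 1) ≡ true → (diff y x ≡ᵇ 1) ≡ true → ⊥
    both e e′ = ℕ.<⇒≢ N≥2 (sym (begin
      N                   ≡⟨ sym (m<n⇒m%n≡m (ℕ.n<1+n N)) ⟩
      neg 1               ≡⟨ cong neg (sym (≡ᵇ-true {diff x y} e)) ⟩
      neg (diff x y)      ≡⟨ sym (sub-swap (toℕ x) (toℕ y) (toℕ<n x) (toℕ<n y)) ⟩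
      diff y x            ≡⟨ ≡ᵇ-true {diff y x} e′ ⟩
      1                   ∎))
      where
      ≡ᵇ-true : ∀ {k} → (k ≡ᵇ 1) ≡ true → k ≡ 1
      ≡ᵇ-true {k} e = ℕ.≡ᵇ⇒≡ k 1 (Equivalence.from T-≡ e)

  Cn-simple : Simple (Cn n)
  Cn-simple .symmetric x y = ∨-comm (diff x y ≡ᵇ 1) (diff y x ≡ᵇ 1)
  Cn-simple .loopless  x   = cong (λ d → (d ≡ᵇ 1) ∨ (d ≡ᵇ 1)) (diff-self x)

  Cn-white : ∀ x → col (Cn n) x ≡ white
  Cn-white x = cong (λ b → if b then white else black)
    (trans (degree-parity (adj (Cn n)) x) (cong not (trans (⊕-sum-cong (λ y → trans (cycle-adj x y) (sym (∧-identityʳ _))))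
                             (⊕-sum-δ₂ (nextF x) (prevF x) (λ _ → true)))))

  apply-Cn : ∀ a x → apply (Cn n) a x ≡ a x xor (a (nextF x) xor a (prevF x))
  apply-Cn a x = begin
    apply (Cn n) a x
      ≡⟨ apply-adj Cn-simple a x ⟩
    ⊕-sum (λ y → adj (Cn n) x y ∧ a y) xor (isWhite (col (Cn n) x) ∧ a x)
      ≡⟨ cong₂ _xor_ (trans (⊕-sum-cong (λ y → cong (_∧ a y) (cycle-adj x y))) (⊕-sum-δ₂ (nextF x) (prevF x) a))
                     (cong (λ c → isWhite c ∧ a x) (Cn-white x)) ⟩
    (a (nextF x) xor a (prevF x)) xor a x
      ≡⟨ xor-comm _ (a x) ⟩
    a x xor (a (nextF x) xor a (prevF x)) ∎

-- Circulant matrices of period three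

skip : ℕ → ℕ → Bool
skip r j = not (j % 3 ≡ᵇ r)

skip-triple : ∀ r → r < 3 → ∀ k → skip r k xor (skip r (suc k) xor skip r (suc (suc k))) ≡ false
skip-triple 0 _ 0 = refl
skip-triple 0 _ 1 = refl
skip-triple 0 _ 2 = refl
skip-triple 1 _ 0 = refl
skip-triple 1 _ 1 = refl
skip-triple 1 _ 2 = refl
skip-triple 2 _ 0 = refl
skip-triple 2 _ 1 = refl
skip-triple 2 _ 2 = refl
skip-triple r r<3 (suc (suc (suc k))) = skip-triple r r<3 k
skip-triple (suc (suc (suc r))) (s≤s (s≤s (s≤s ()))) _

module _ (N : ℕ) where
  open Residues N

  prev-suc : ∀ k → k < N → prev (suc k) ≡ k
  prev-suc k k<N = trans (cong (_% suc N) (trans (+-suc N k) (+-comm (suc N) k)))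
                         (trans ([m+n]%n≡m%n k (suc N)) (m<n⇒m%n≡m (s≤s (<⇒≤ k<N))))

  -- Only the rows 0 and N, where the cycle wraps around, are not instances of the
  -- triple-sum property of q.
  circulant-rows : ∀ (f q : ℕ → Bool) b → 1 ≤ N →
    (∀ j → j ≤ N → f j ≡ q j) →
    (∀ k → q k xor (q (suc k) xor q (suc (suc k))) ≡ false) →
    q 0 xor (q 1 xor q N) ≡ b →
    q N xor (q 0 xor q (N ∸ 1)) ≡ false →
    ∀ k → k < suc N → f k xor (f (next k) xor f (prev k)) ≡ (b ∧ (k ≡ᵇ 0))
  circulant-rows f q b N≥1 f≡q sums first last zero _ =
    trans (cong₂ (λ i j → f 0 xor (f i xor f j)) (m<n⇒m%n≡m (s≤s N≥1))
                 (trans (cong (_% suc N) (+-identityʳ N)) (m<n⇒m%n≡m ≤-refl)))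
          (trans (cong₂ _xor_ (f≡q 0 z≤n) (cong₂ _xor_ (f≡q 1 N≥1) (f≡q N ≤-refl)))
                 (trans first (sym (∧-identityʳ b))))
  circulant-rows f q b N≥1 f≡q sums first last (suc k) (s≤s k<N) with m≤n⇒m<n∨m≡n k<N
  ... | inj₂ refl =
    trans (cong₂ (λ i j → f (suc k) xor (f i xor f j)) (n%n≡0 (suc N)) (prev-suc k ≤-refl))
          (trans (cong₂ _xor_ (f≡q (suc k) ≤-refl) (cong₂ _xor_ (f≡q 0 z≤n) (f≡q k (n≤1+n k))))
                 (trans last (sym (∧-zeroʳ b))))
  ... | inj₁ sk<N =
    trans (cong₂ (λ i j → f (suc k) xor (f i xor f j)) (m<n⇒m%n≡m (s≤s sk<N)) (prev-suc k (<⇒≤ sk<N)))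
          (trans (cong₂ _xor_ (f≡q (suc k) (<⇒≤ sk<N)) (cong₂ _xor_ (f≡q (suc (suc k)) sk<N) (f≡q k (<⇒≤ (<⇒≤ sk<N)))))
                 (trans (rotate (q (suc k)) (q (suc (suc k))) (q k)) (trans (sums k) (sym (∧-zeroʳ b)))))
    where
    rotate : ∀ a b c → a xor (b xor c) ≡ c xor (a xor b)
    rotate = solve-∀ boolRing

closed : ℕ → (ℕ → Bool) → ℕ → Bool
closed N S d = (d ≡ᵇ 0) ∨ (S d ∨ S (Residues.neg N d))

private
  ≤ᵇ-true : ∀ {a b} → a ≤ b → (a ≤ᵇ b) ≡ true
  ≤ᵇ-true a≤b = Equivalence.to T-≡ (≤⇒≤ᵇ a≤b)

  3m%3 : ∀ m → (3 * m) % 3 ≡ 0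
  3m%3 m = trans (cong (_% 3) (*-comm 3 m)) ([m+kn]%n≡m%n 0 m 3)

  1+3m%3 : ∀ m → suc (3 * m) % 3 ≡ 1
  1+3m%3 m = trans (cong (λ z → (1 + z) % 3) (*-comm 3 m)) ([m+kn]%n≡m%n 1 m 3)

  2+3m%3 : ∀ m → suc (suc (3 * m)) % 3 ≡ 2
  2+3m%3 m = trans (cong (λ z → (2 + z) % 3) (*-comm 3 m)) ([m+kn]%n≡m%n 2 m 3)

  neg-suc : ∀ N j → j < N → Residues.neg N (suc j) ≡ N ∸ j
  neg-suc N j j<N = m<n⇒m%n≡m (s≤s (m∸n≤m N j))

  residues-add : ∀ N j → j < N → ((N ∸ j) % 3 + suc j % 3) % 3 ≡ suc N % 3
  residues-add N j j<N = trans (sym (%-distribˡ-+ (N ∸ j) (suc j) 3))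
    (cong (_% 3) (trans (+-suc (N ∸ j) j) (cong suc (m∸n+n≡m (<⇒≤ j<N)))))

  pos∸ : ∀ N j → j < N → 1 ≤ N ∸ j
  pos∸ (suc N) zero    _         = s≤s z≤n
  pos∸ (suc N) (suc j) (s≤s j<N) = pos∸ N j j<N

  P₁ : ℕ → Bool
  P₁ t = (t ≡ᵇ 0) ∨ (t ≡ᵇ 1)

  P₂ : ℕ → Bool
  P₂ t = (t ≡ᵇ 0) ∨ (t ≡ᵇ 2)

  S₁-in : ∀ m k → 1 ≤ k → k ≤ 3 * m → S₁ m k ≡ P₁ (k % 3)
  S₁-in m k 1≤k k≤3m rewrite ≤ᵇ-true 1≤k | ≤ᵇ-true k≤3m = refl

  ≤ᵇ-suc : ∀ a → (suc a ≤ᵇ a) ≡ false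
  ≤ᵇ-suc zero    = refl
  ≤ᵇ-suc (suc a) = ≤ᵇ-suc a

  S₂-in : ∀ m k → 1 ≤ k → k ≤ suc (3 * m) → S₂ m k ≡ P₂ (k % 3)
  S₂-in m k 1≤k k≤ with m≤n⇒m<n∨m≡n k≤
  ... | inj₁ (s≤s k≤3m) rewrite ≤ᵇ-true 1≤k | ≤ᵇ-true k≤3m = refl
  ... | inj₂ refl rewrite ≤ᵇ-true 1≤k | 1+3m%3 m | ≤ᵇ-suc (3 * m) = refl

  table₁ : ∀ u t → u < 3 → t < 3 → (u + t) % 3 ≡ 1 → P₁ t ∨ P₁ u ≡ not (t ≡ᵇ 2)
  table₁ 0 1 _ _ _ = refl
  table₁ 1 0 _ _ _ = refl
  table₁ 2 2 _ _ _ = refl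
  table₁ 0 0 _ _ ()
  table₁ 0 2 _ _ ()
  table₁ 1 1 _ _ ()
  table₁ 1 2 _ _ ()
  table₁ 2 0 _ _ ()
  table₁ 2 1 _ _ ()
  table₁ (suc (suc (suc u))) t (s≤s (s≤s (s≤s ()))) _ _
  table₁ u (suc (suc (suc t))) _ (s≤s (s≤s (s≤s ()))) _

  table₂ : ∀ u t → u < 3 → t < 3 → (u + t) % 3 ≡ 2 → P₂ t ∨ P₂ u ≡ not (t ≡ᵇ 1)
  table₂ 0 2 _ _ _ = refl
  table₂ 1 1 _ _ _ = refl
  table₂ 2 0 _ _ _ = refl
  table₂ 0 0 _ _ ()
  table₂ 0 1 _ _ ()
  table₂ 1 0 _ _ ()
  table₂ 1 2 _ _ ()
  table₂ 2 1 _ _ ()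
  table₂ 2 2 _ _ ()
  table₂ (suc (suc (suc u))) t (s≤s (s≤s (s≤s ()))) _ _
  table₂ u (suc (suc (suc t))) _ (s≤s (s≤s (s≤s ()))) _

closed-S₁ : ∀ m j → j ≤ 3 * m → closed (3 * m) (S₁ m) j ≡ skip 2 j
closed-S₁ m zero    _    = refl
closed-S₁ m (suc j) j<N =
  trans (cong (λ z → S₁ m (suc j) ∨ S₁ m z) (neg-suc N j j<N))
        (trans (cong₂ _∨_ (S₁-in m (suc j) (s≤s z≤n) j<N) (S₁-in m (N ∸ j) (pos∸ N j j<N) (m∸n≤m N j)))
               (table₁ ((N ∸ j) % 3) (suc j % 3) (m%n<n (N ∸ j) 3) (m%n<n (suc j) 3)
                       (trans (residues-add N j j<N) (1+3m%3 m))))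
  where N = 3 * m

closed-S₂ : ∀ m j → j ≤ suc (3 * m) → closed (suc (3 * m)) (S₂ m) j ≡ skip 1 j
closed-S₂ m zero    _    = refl
closed-S₂ m (suc j) j<N =
  trans (cong (λ z → S₂ m (suc j) ∨ S₂ m z) (neg-suc N j j<N))
        (trans (cong₂ _∨_ (S₂-in m (suc j) (s≤s z≤n) j<N) (S₂-in m (N ∸ j) (pos∸ N j j<N) (m∸n≤m N j)))
               (table₂ ((N ∸ j) % 3) (suc j % 3) (m%n<n (N ∸ j) 3) (m%n<n (suc j) 3)
                       (trans (residues-add N j j<N) (2+3m%3 m))))
  where N = suc (3 * m)

CirculantRows : ℕ → (ℕ → Bool) → Bool → Set
CirculantRows N f b = ∀ k → k < suc N → f k xor (f (Residues.next N k) xor f (Residues.prev N k)) ≡ (b ∧ (k ≡ᵇ 0))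

private
  pred-%3 : ∀ a r → suc a % 3 ≡ suc r → a % 3 ≡ r
  pred-%3 0 0 _ = refl
  pred-%3 1 1 _ = refl
  pred-%3 (suc (suc (suc a))) r e = pred-%3 a r e
  pred-%3 0 (suc r) ()
  pred-%3 1 0 ()
  pred-%3 1 (suc (suc r)) ()
  pred-%3 2 r ()

  suc[a∸1]≡a : ∀ {a} → 1 ≤ a → suc (a ∸ 1) ≡ a
  suc[a∸1]≡a (s≤s _) = refl

circulant-S₁ : ∀ m → 1 ≤ m → CirculantRows (3 * m) (closed (3 * m) (S₁ m)) true
circulant-S₁ m m≥1 =
  circulant-rows (3 * m) (closed (3 * m) (S₁ m)) (skip 2) true N≥1 (closed-S₁ m) (skip-triple 2 (s≤s (s≤s (s≤s z≤n))))
    (cong (λ t → true xor (true xor not (t ≡ᵇ 2))) (3m%3 m))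
    (cong₂ (λ t t′ → not (t ≡ᵇ 2) xor (true xor not (t′ ≡ᵇ 2))) (3m%3 m)
           (%-pred-≡0 {3 * m ∸ 1} {3} (trans (cong (_% 3) (suc[a∸1]≡a N≥1)) (3m%3 m))))
  where
  N≥1 : 1 ≤ 3 * m
  N≥1 = ≤-trans m≥1 (m≤m+n m (m + (m + 0)))

circulant-S₂ : ∀ m → CirculantRows (suc (3 * m)) (closed (suc (3 * m)) (S₂ m)) true
circulant-S₂ m =
  circulant-rows (suc (3 * m)) (closed (suc (3 * m)) (S₂ m)) (skip 1) true (s≤s z≤n) (closed-S₂ m)
    (skip-triple 1 (s≤s (s≤s z≤n)))
    (cong (λ t → true xor (false xor not (t ≡ᵇ 1))) (1+3m%3 m))
    (cong₂ (λ t t′ → not (t ≡ᵇ 1) xor (true xor not (t′ ≡ᵇ 1))) (1+3m%3 m) (3m%3 m))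

circulant-kernel : ∀ N → suc N % 3 ≡ 0 → 2 ≤ N → CirculantRows N (skip 0) false
circulant-kernel N 3∣n N≥2 =
  circulant-rows N (skip 0) (skip 0) false (≤-trans (s≤s z≤n) N≥2) (λ _ _ → refl) (skip-triple 0 (s≤s z≤n))
    (cong (λ t → false xor (true xor not (t ≡ᵇ 0))) N%3)
    (cong₂ (λ t t′ → not (t ≡ᵇ 0) xor (false xor not (t′ ≡ᵇ 0))) N%3
           (pred-%3 (N ∸ 1) 1 (trans (cong (_% 3) (suc[a∸1]≡a (≤-trans (s≤s z≤n) N≥2))) N%3)))
  where
  N%3 : N % 3 ≡ 2
  N%3 = %-pred-≡0 {N} {3} 3∣n

module CycleInverse (N : ℕ) (N≥2 : 2 ≤ N) where
  open Cycle N N≥2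

  private
    n = suc N

  diff-nextF : ∀ x z → diff (nextF x) z ≡ next (diff x z)
  diff-nextF x z = trans (cong (λ a → sub a (toℕ z)) (toℕ-nextF x)) (sub-next (toℕ x) (toℕ z))

  diff-prevF : ∀ x z → diff (prevF x) z ≡ prev (diff x z)
  diff-prevF x z = trans (cong (λ a → sub a (toℕ z)) (toℕ-prevF x)) (sub-prev (toℕ x) (toℕ z))

  closedMatrix : (ℕ → Bool) → Fin n → Fin n → Bool
  closedMatrix S y z = if δ y z then true else cay n S y z

  closedMatrix-diff : ∀ S y z → closedMatrix S y z ≡ closed N S (diff y z)
  closedMatrix-diff S y z =
    trans (cong (λ b → if b then true else cay n S y z) (δ-diff y z))
          (trans (if-true-else (diff y z ≡ᵇ 0) (cay n S y z))
                 (cong (λ d → (diff y z ≡ᵇ 0) ∨ (S (diff y z) ∨ S d)) (sub-swap (toℕ y) (toℕ z) (toℕ<n y) (toℕ<n z))))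
    where
    if-true-else : ∀ b c → (if b then true else c) ≡ b ∨ c
    if-true-else false c = refl
    if-true-else true  c = refl

  cycle-rightInverse : ∀ S → CirculantRows N (closed N S) true → RightInverse (Cn n) (closedMatrix S)
  cycle-rightInverse S rows z x = begin
    apply (Cn n) (λ y → closedMatrix S y z) x
      ≡⟨ apply-Cn (λ y → closedMatrix S y z) x ⟩
    closedMatrix S x z xor (closedMatrix S (nextF x) z xor closedMatrix S (prevF x) z)
      ≡⟨ cong₂ _xor_ (closedMatrix-diff S x z)
           (cong₂ _xor_ (trans (closedMatrix-diff S (nextF x) z) (cong (closed N S) (diff-nextF x z)))
                        (trans (closedMatrix-diff S (prevF x) z) (cong (closed N S) (diff-prevF x z)))) ⟩
    f d xor (f (next d) xor f (prev d))
      ≡⟨ rows d (sub<n (toℕ x) (toℕ z)) ⟩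
    (d ≡ᵇ 0)
      ≡⟨ sym (δ-diff x z) ⟩
    δ x z ∎
    where
    f = closed N S
    d = diff x z

  kernel-vector : Fin n → Bool
  kernel-vector x = skip 0 (toℕ x)

  in-kernel : suc N % 3 ≡ 0 → ∀ x → apply (Cn n) kernel-vector x ≡ false
  in-kernel 3∣n x = trans (apply-Cn kernel-vector x)
      (trans (cong₂ (λ i j → skip 0 (toℕ x) xor (skip 0 i xor skip 0 j)) (toℕ-nextF x) (toℕ-prevF x))
             (circulant-kernel N 3∣n N≥2 (toℕ x) (toℕ<n x)))

  cycle-singular : suc N % 3 ≡ 0 → ¬ Nonsingular (Cn n)
  cycle-singular 3∣n nonsingular = true≢false (trans (sym kernel-at-1) (nonsingular kernel-vector (in-kernel 3∣n) (fromℕ< 1<n)))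
    where
    true≢false : true ≢ false
    true≢false ()
    kernel-at-1 : kernel-vector (fromℕ< 1<n) ≡ true
    kernel-at-1 = cong (skip 0) (toℕ-fromℕ< 1<n)

  cycle-invertible : ∀ S → CirculantRows N (closed N S) true → Invertible (Cn n)
  cycle-invertible S rows =
    invertible-if-nonsingular Cn-simple (rightInverse⇒nonsingular {C = closedMatrix S} Cn-simple (cycle-rightInverse S rows))

  cycle-inverse : ∀ S → S 0 ≡ false → CirculantRows N (closed N S) true →
    ∀ s → InvertingWord (Cn n) s → ∀ x y → adj (Cn n · s) x y ≡ cay n S x y
  cycle-inverse S S0 rows s iw x y with x ≟ y
  ... | yes refl = trans (loopless (·-simple Cn-simple s) x)
                         (sym (trans (cong (λ d → S d ∨ S d) (diff-self x)) (cong (λ b → b ∨ b) S0)))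
  ... | no x≢y = trans (sym (matrix-≢ (Cn n · s) x≢y))
                   (trans (leftInverse-unique {G = Cn n} {X = Cn n · s} {C = closedMatrix S} (cycle-rightInverse S rows) (invertingWord-inverse {G = Cn n} Cn-simple iw) x y)
                          (cong (λ b → if b then true else cay n S x y) (δ-≢ x≢y)))

-- Invertibility of the cycle

residue-cases : ∀ N → (Σ ℕ λ q → N ≡ 3 * q) ⊎ (Σ ℕ λ q → N ≡ suc (3 * q)) ⊎ suc N % 3 ≡ 0
residue-cases 0 = inj₁ (0 , refl)
residue-cases 1 = inj₂ (inj₁ (0 , refl))
residue-cases 2 = inj₂ (inj₂ refl)
residue-cases (suc (suc (suc N))) with residue-cases N
... | inj₁ (q , refl)        = inj₁ (suc q , sym (*-suc 3 q))
... | inj₂ (inj₁ (q , refl)) = inj₂ (inj₁ (suc q , cong suc (sym (*-suc 3 q))))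
... | inj₂ (inj₂ 3∣n)        = inj₂ (inj₂ 3∣n)

2≤3*m : ∀ m → 1 ≤ m → 2 ≤ 3 * m
2≤3*m m m≥1 = ≤-trans (s≤s (s≤s z≤n)) (*-monoʳ-≤ 3 m≥1)

invertible-unless-3∣ : ∀ N → 2 ≤ N → ¬ (suc N % 3 ≡ 0) → Invertible (Cn (suc N))
invertible-unless-3∣ N N≥2 3∤n with residue-cases N
... | inj₁ (q , refl) = CycleInverse.cycle-invertible (3 * q) N≥2 (S₁ q) (circulant-S₁ q (positive q N≥2))
  where
  positive : ∀ q → 2 ≤ 3 * q → 1 ≤ q
  positive (suc q) _ = s≤s z≤n
... | inj₂ (inj₁ (q , refl)) = CycleInverse.cycle-invertible (suc (3 * q)) N≥2 (S₂ q) (circulant-S₂ q)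
... | inj₂ (inj₂ 3∣n)        = contradiction 3∣n 3∤n

cycle-invertible-iff : (n : ℕ) → 3 ≤ n → (Invertible (Cn n) ⇔ (¬ (n % 3 ≡ 0)))
cycle-invertible-iff (suc N) (s≤s N≥2) = mk⇔
  (λ invertible 3∣n → CycleInverse.cycle-singular N N≥2 3∣n (invertible⇒nonsingular (Cycle.Cn-simple N N≥2) invertible))
  (invertible-unless-3∣ N N≥2)

inverse-C₃ₘ₊₁ : (m : ℕ) → 1 ≤ m → (s : List (Fin (3 * m + 1))) → InvertingWord (Cn (3 * m + 1)) s →
  (x y : Fin (3 * m + 1)) → adj (Cn (3 * m + 1) · s) x y ≡ cay (3 * m + 1) (S₁ m) x y
inverse-C₃ₘ₊₁ m m≥1 =
  subst (λ n → (s : List (Fin n)) → InvertingWord (Cn n) s → (x y : Fin n) → adj (Cn n · s) x y ≡ cay n (S₁ m) x y)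
        (+-comm 1 (3 * m))
        (CycleInverse.cycle-inverse (3 * m) (2≤3*m m m≥1) (S₁ m) refl (circulant-S₁ m m≥1))

inverse-C₃ₘ₊₂ : (m : ℕ) → 1 ≤ m → (s : List (Fin (3 * m + 2))) → InvertingWord (Cn (3 * m + 2)) s →
  (x y : Fin (3 * m + 2)) → adj (Cn (3 * m + 2) · s) x y ≡ cay (3 * m + 2) (S₂ m) x y
inverse-C₃ₘ₊₂ m m≥1 =
  subst (λ n → (s : List (Fin n)) → InvertingWord (Cn n) s → (x y : Fin n) → adj (Cn n · s) x y ≡ cay n (S₂ m) x y)
        (+-comm 2 (3 * m))
        (CycleInverse.cycle-inverse (suc (3 * m)) (≤-trans (2≤3*m m m≥1) (n≤1+n _)) (S₂ m) refl (circulant-S₂ m))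

proposition1p7p5 : ((n : ℕ) → 3 ≤ n → (Invertible (Cn n) ⇔ (¬ (n % 3 ≡ 0))))
    × ((m : ℕ) → 1 ≤ m → (s : List (Fin (3 * m + 1))) → InvertingWord (Cn (3 * m + 1)) s →
        (x y : Fin (3 * m + 1)) → adj (Cn (3 * m + 1) · s) x y ≡ cay (3 * m + 1) (S₁ m) x y)
    × ((m : ℕ) → 1 ≤ m → (s : List (Fin (3 * m + 2))) → InvertingWord (Cn (3 * m + 2)) s →
        (x y : Fin (3 * m + 2)) → adj (Cn (3 * m + 2) · s) x y ≡ cay (3 * m + 2) (S₂ m) x y)
proposition1p7p5 = cycle-invertible-iff , inverse-C₃ₘ₊₁ , inverse-C₃ₘ₊₂
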